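{- For all integers $i\ge 0$ and $q\ge 2$, $v_{2^{q-1}+i}\equiv v_i+2^{q-1}\pmod{2^q}$.
   Context: For an integer $n\ge 1$ let $v_n=\Big[(1-x)\prod_{j=0}^{2n-3}(2n-3-j+jx)\Big]_{x^{n-1}}$, where $[f(x)]_{x^m}$ denotes the coefficient of $x^m$ in $f$ (an empty product equals $1$, so $v_1=1$), and set $v_0=-1$. -}

module Defs where

open import Data.Nat as ℕ using (ℕ; zero; suc; _∸_)
open import Data.Integer as ℤ using (ℤ; +_; _+_; _*_; -_; 0ℤ; 1ℤ)
open import Data.List using (List; []; _∷_; map; upTo; foldr; lookup)
open import Data.Integer.Divisibility using (_∣_)

-- Polynomials over ℤ as coefficient lists, lowest degree first.
Poly : Set
Poly = List ℤ

_⊕_ : Poly → Poly → Poly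
[] ⊕ q = q
(a ∷ p) ⊕ [] = a ∷ p
(a ∷ p) ⊕ (b ∷ q) = (a + b) ∷ (p ⊕ q)

scale : ℤ → Poly → Poly
scale c = map (c *_)

_⊗_ : Poly → Poly → Poly
[] ⊗ q = []
(a ∷ p) ⊗ q = scale a q ⊕ (0ℤ ∷ (p ⊗ q))

coeff : Poly → ℕ → ℤ
coeff [] m = 0ℤ
coeff (a ∷ p) zero = a
coeff (a ∷ p) (suc m) = coeff p m

factor : ℕ → ℕ → Poly
factor N j = (+ (N ∸ j)) ∷ (+ j) ∷ []

-- ∏_{j=0}^{2n-3} (2n-3-j + j x); the index range j = 0 .. 2n-3 has 2n-2 elements
-- (empty when n = 1)
prodPoly : ℕ → Poly
prodPoly n = foldr (λ j acc → factor (2 ℕ.* n ∸ 3) j ⊗ acc) (1ℤ ∷ []) (upTo (2 ℕ.* n ∸ 2))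

oneMinusX : Poly
oneMinusX = 1ℤ ∷ (- 1ℤ) ∷ []

v : ℕ → ℤ
v zero = - 1ℤ
v (suc k) = coeff (oneMinusX ⊗ prodPoly (suc k)) k

_≡_[mod_] : ℤ → ℤ → ℤ → Set
a ≡ b [mod m ] = m ∣ (a ℤ.- b)

{-# OPTIONS --safe #-}
module Submission where

-- Write P_n = ∏_{β=0}^{2n-3} ((K - β) + β x) with K = 2n - 3, so that v_n = [(1 - x) P_n]_{x^{n-1}}.
-- The factors at β and K - β multiply to K² x + β(K - β)(1 - x)², which is x modulo 2 when K is
-- odd; hence P_{j+1} ≡ x^j (mod 2).
-- Let M = 2^{q-1}. The middle 2M factors of P_{M+j+1} form a block S that is symmetric about its own
-- centre, and the remaining factors agree with those of P_{j+1} modulo 2M, so P_{M+j+1} ≡ P_{j+1} S.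
-- By induction on q, using that a symmetric block of 2^{q+1} factors is congruent to the square
-- of one of 2^q factors modulo 2^{q+1}, S ≡ x^M + M D (mod 2M) with D_M - D_{M-1} odd. Reading off
-- the coefficient of x^{M+j} gives v_{M+j+1} ≡ v_{j+1} + M (D_M - D_{M-1}) ≡ v_{j+1} + M.
-- For i = 0 the block starting at β = -1 is P_M with the two extra factors -(2 + x) and -(1 + 2x);
-- dividing x^M + M D by them coefficientwise modulo 2M gives v_M ≡ -1 + M.

open import Defs

-- The development sits in an anonymous module so that its integer operators stay out of scope in
-- the statement of mainTheorem16, which uses the natural-number ones.
module _ where
  open import Algebra.Bundles using (CommutativeRing)
  open import Data.Integer.Divisibility.Signed using (_∣_; divides; ∣-trans; ∣m∣n⇒∣m+n; ∣m∣n⇒∣m-n; ∣m⇒∣-m; *-monoʳ-∣)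
  open import Data.Integer using (ℤ; +_; -[1+_]; 0ℤ; 1ℤ; -1ℤ; _+_; _*_; -_; _-_)
  import Data.Integer.Properties as ℤₚ
  open import Data.Integer.Tactic.RingSolver using (solve-∀) renaming (solve to solveℤ)
  open import Data.List using ([]; _∷_; foldr; applyUpTo; upTo; length)
  open import Data.Maybe using (Maybe; just; nothing)
  open import Data.Nat as ℕ using (ℕ; zero; suc; z≤n; s≤s; _^_)
  open import Data.Nat.Tactic.RingSolver using () renaming (solve-∀ to ℕ-solve-∀)
  import Data.Nat.Properties as ℕₚ
  open import Data.Product using (_,_)
  open import Relation.Nullary using (contradiction)
  open import Level using (0ℓ)
  open import Function using (_∘_; id)
  open import Relation.Binary.PropositionalEquality
  open import Relation.Binary.Bundles using (Setoid)
  import Relation.Binary.Reasoning.Setoid as SetoidReasoning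
  import Tactic.RingSolver.Core.AlmostCommutativeRing as ACR
  import Tactic.RingSolver.NonReflective as NonReflective

  -- Polynomial arithmetic

  infix 4 _≈_
  record _≈_ (p q : Poly) : Set where
    constructor mk≈
    field coeff-≡ : ∀ k → coeff p k ≡ coeff q k
  open _≈_

  ≈-refl : ∀ {p} → p ≈ p
  ≈-refl = mk≈ λ _ → refl

  ≈-sym : ∀ {p q} → p ≈ q → q ≈ p
  ≈-sym e = mk≈ λ k → sym (coeff-≡ e k)

  ≈-trans : ∀ {p q r} → p ≈ q → q ≈ r → p ≈ r
  ≈-trans e f = mk≈ λ k → trans (coeff-≡ e k) (coeff-≡ f k)

  ≈-reflexive : ∀ {p q} → p ≡ q → p ≈ q
  ≈-reflexive refl = ≈-refl

  coeff-⊕ : ∀ p q k → coeff (p ⊕ q) k ≡ coeff p k + coeff q k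
  coeff-⊕ []      q       k       = sym (ℤₚ.+-identityˡ _)
  coeff-⊕ (a ∷ p) []      k       = sym (ℤₚ.+-identityʳ _)
  coeff-⊕ (a ∷ p) (b ∷ q) zero    = refl
  coeff-⊕ (a ∷ p) (b ∷ q) (suc k) = coeff-⊕ p q k

  coeff-scale : ∀ c p k → coeff (scale c p) k ≡ c * coeff p k
  coeff-scale c []      k       = sym (ℤₚ.*-zeroʳ c)
  coeff-scale c (a ∷ p) zero    = refl
  coeff-scale c (a ∷ p) (suc k) = coeff-scale c p k

  -- conv f g k = Σ_{i ≤ k} f i * g (k - i)
  conv : (ℕ → ℤ) → (ℕ → ℤ) → ℕ → ℤ
  conv f g zero    = f 0 * g 0
  conv f g (suc k) = f 0 * g (suc k) + conv (f ∘ suc) g k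

  conv-cong : ∀ {f f′ g g′} → (∀ i → f i ≡ f′ i) → (∀ i → g i ≡ g′ i) → ∀ k → conv f g k ≡ conv f′ g′ k
  conv-cong f≡ g≡ zero    = cong₂ _*_ (f≡ 0) (g≡ 0)
  conv-cong f≡ g≡ (suc k) = cong₂ _+_ (cong₂ _*_ (f≡ 0) (g≡ (suc k))) (conv-cong (f≡ ∘ suc) g≡ k)

  conv-zeroˡ : ∀ g k → conv (λ _ → 0ℤ) g k ≡ 0ℤ
  conv-zeroˡ g zero    = refl
  conv-zeroˡ g (suc k) = trans (ℤₚ.+-identityˡ _) (conv-zeroˡ g k)

  conv-identityˡ : ∀ g k → conv (coeff (1ℤ ∷ [])) g k ≡ g k
  conv-identityˡ g zero    = ℤₚ.*-identityˡ (g 0)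
  conv-identityˡ g (suc k) = begin
    1ℤ * g (suc k) + conv (λ _ → 0ℤ) g k ≡⟨ cong (λ z → 1ℤ * g (suc k) + z) (conv-zeroˡ g k) ⟩
    1ℤ * g (suc k) + 0ℤ                  ≡⟨ ℤₚ.+-identityʳ _ ⟩
    1ℤ * g (suc k)                       ≡⟨ ℤₚ.*-identityˡ _ ⟩
    g (suc k)                            ∎
    where open ≡-Reasoning

  conv-distribʳ : ∀ f f′ g k → conv (λ i → f i + f′ i) g k ≡ conv f g k + conv f′ g k
  conv-distribʳ f f′ g zero    = ℤₚ.*-distribʳ-+ (g 0) (f 0) (f′ 0)
  conv-distribʳ f f′ g (suc k) rewrite conv-distribʳ (f ∘ suc) (f′ ∘ suc) g k =
    shuffle (f 0) (f′ 0) (g (suc k)) _ _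
    where shuffle : ∀ a b c d e → (a + b) * c + (d + e) ≡ (a * c + d) + (b * c + e)
          shuffle = solve-∀

  conv-distribˡ : ∀ f g g′ k → conv f (λ i → g i + g′ i) k ≡ conv f g k + conv f g′ k
  conv-distribˡ f g g′ zero    = ℤₚ.*-distribˡ-+ (f 0) (g 0) (g′ 0)
  conv-distribˡ f g g′ (suc k) rewrite conv-distribˡ (f ∘ suc) g g′ k =
    shuffle (f 0) (g (suc k)) (g′ (suc k)) _ _
    where shuffle : ∀ a b c d e → a * (b + c) + (d + e) ≡ (a * b + d) + (a * c + e)
          shuffle = solve-∀

  conv-*ˡ : ∀ c f g k → conv (λ i → c * f i) g k ≡ c * conv f g k
  conv-*ˡ c f g zero    = ℤₚ.*-assoc c (f 0) (g 0)
  conv-*ˡ c f g (suc k) rewrite conv-*ˡ c (f ∘ suc) g k = shuffle c (f 0) (g (suc k)) _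
    where shuffle : ∀ a b d e → a * b * d + a * e ≡ a * (b * d + e)
          shuffle = solve-∀

  conv-sucʳ : ∀ f g k → conv f g (suc k) ≡ conv f (g ∘ suc) k + f (suc k) * g 0
  conv-sucʳ f g zero    = refl
  conv-sucʳ f g (suc k) rewrite conv-sucʳ (f ∘ suc) g k =
    sym (ℤₚ.+-assoc (f 0 * g (suc (suc k))) (conv (f ∘ suc) (g ∘ suc) k) (f (suc (suc k)) * g 0))

  conv-comm : ∀ f g k → conv f g k ≡ conv g f k
  conv-comm f g zero    = ℤₚ.*-comm (f 0) (g 0)
  conv-comm f g (suc k) rewrite conv-comm (f ∘ suc) g k | conv-sucʳ g f k = shuffle (f 0) (g (suc k)) _
    where shuffle : ∀ a b c → a * b + c ≡ c + b * a
          shuffle = solve-∀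

  conv-assoc : ∀ f g h k → conv (conv f g) h k ≡ conv f (conv g h) k
  conv-assoc f g h zero    = ℤₚ.*-assoc (f 0) (g 0) (h 0)
  conv-assoc f g h (suc k) = begin
    conv f g 0 * h (suc k) + conv (λ i → f 0 * g (suc i) + conv (f ∘ suc) g i) h k
      ≡⟨ cong (λ z → conv f g 0 * h (suc k) + z) (conv-distribʳ _ _ h k) ⟩
    conv f g 0 * h (suc k) + (conv (λ i → f 0 * g (suc i)) h k + conv (conv (f ∘ suc) g) h k)
      ≡⟨ cong₂ (λ a b → conv f g 0 * h (suc k) + (a + b)) (conv-*ˡ (f 0) (g ∘ suc) h k) (conv-assoc (f ∘ suc) g h k) ⟩
    f 0 * g 0 * h (suc k) + (f 0 * conv (g ∘ suc) h k + conv (f ∘ suc) (conv g h) k)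
      ≡⟨ shuffle (f 0) (g 0) (h (suc k)) _ _ ⟩
    f 0 * (g 0 * h (suc k) + conv (g ∘ suc) h k) + conv (f ∘ suc) (conv g h) k ∎
    where open ≡-Reasoning
          shuffle : ∀ a b c d e → a * b * c + (a * d + e) ≡ a * (b * c + d) + e
          shuffle = solve-∀

  coeff-⊗ : ∀ p q k → coeff (p ⊗ q) k ≡ conv (coeff p) (coeff q) k
  coeff-⊗ []      q k       = sym (conv-zeroˡ (coeff q) k)
  coeff-⊗ (a ∷ p) q zero    = begin
    coeff (scale a q ⊕ (0ℤ ∷ (p ⊗ q))) 0 ≡⟨ coeff-⊕ (scale a q) _ 0 ⟩
    coeff (scale a q) 0 + 0ℤ             ≡⟨ ℤₚ.+-identityʳ _ ⟩
    coeff (scale a q) 0                  ≡⟨ coeff-scale a q 0 ⟩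
    a * coeff q 0                        ∎
    where open ≡-Reasoning
  coeff-⊗ (a ∷ p) q (suc k) = trans (coeff-⊕ (scale a q) (0ℤ ∷ (p ⊗ q)) (suc k))
    (cong₂ _+_ (coeff-scale a q (suc k)) (coeff-⊗ p q k))

  infix 25 ⊖_
  ⊖_ : Poly → Poly
  ⊖_ = scale -1ℤ

  one : Poly
  one = 1ℤ ∷ []

  ⊕-cong : ∀ {p p′ q q′} → p ≈ p′ → q ≈ q′ → p ⊕ q ≈ p′ ⊕ q′
  ⊕-cong {p} {p′} {q} {q′} e f = mk≈ λ k →
    trans (coeff-⊕ p q k) (trans (cong₂ _+_ (coeff-≡ e k) (coeff-≡ f k)) (sym (coeff-⊕ p′ q′ k)))

  ⊗-cong : ∀ {p p′ q q′} → p ≈ p′ → q ≈ q′ → p ⊗ q ≈ p′ ⊗ q′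
  ⊗-cong {p} {p′} {q} {q′} e f = mk≈ λ k →
    trans (coeff-⊗ p q k) (trans (conv-cong (coeff-≡ e) (coeff-≡ f) k) (sym (coeff-⊗ p′ q′ k)))

  ⊖-cong : ∀ {p q} → p ≈ q → ⊖ p ≈ ⊖ q
  ⊖-cong {p} {q} e = mk≈ λ k →
    trans (coeff-scale -1ℤ p k) (trans (cong (-1ℤ *_) (coeff-≡ e k)) (sym (coeff-scale -1ℤ q k)))

  ⊕-assoc : ∀ p q r → (p ⊕ q) ⊕ r ≈ p ⊕ (q ⊕ r)
  ⊕-assoc p q r = mk≈ λ k → begin
    coeff ((p ⊕ q) ⊕ r) k              ≡⟨ coeff-⊕ (p ⊕ q) r k ⟩
    coeff (p ⊕ q) k + coeff r k        ≡⟨ cong (_+ coeff r k) (coeff-⊕ p q k) ⟩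
    coeff p k + coeff q k + coeff r k  ≡⟨ ℤₚ.+-assoc (coeff p k) _ _ ⟩
    coeff p k + (coeff q k + coeff r k) ≡⟨ cong (λ z → coeff p k + z) (coeff-⊕ q r k) ⟨
    coeff p k + coeff (q ⊕ r) k        ≡⟨ coeff-⊕ p (q ⊕ r) k ⟨
    coeff (p ⊕ (q ⊕ r)) k              ∎
    where open ≡-Reasoning

  ⊕-comm : ∀ p q → p ⊕ q ≈ q ⊕ p
  ⊕-comm p q = mk≈ λ k →
    trans (coeff-⊕ p q k) (trans (ℤₚ.+-comm (coeff p k) _) (sym (coeff-⊕ q p k)))

  ⊕-identityʳ : ∀ p → p ⊕ [] ≈ p
  ⊕-identityʳ p = mk≈ λ k → trans (coeff-⊕ p [] k) (ℤₚ.+-identityʳ (coeff p k))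

  ⊕-inverseˡ : ∀ p → (⊖ p) ⊕ p ≈ []
  ⊕-inverseˡ p = mk≈ λ k →
    trans (coeff-⊕ (⊖ p) p k) (trans (cong (_+ coeff p k) (coeff-scale -1ℤ p k)) (cancel (coeff p k)))
    where cancel : ∀ x → -1ℤ * x + x ≡ 0ℤ
          cancel = solve-∀

  ⊕-inverseʳ : ∀ p → p ⊕ (⊖ p) ≈ []
  ⊕-inverseʳ p = ≈-trans (⊕-comm p (⊖ p)) (⊕-inverseˡ p)

  ⊗-assoc : ∀ p q r → (p ⊗ q) ⊗ r ≈ p ⊗ (q ⊗ r)
  ⊗-assoc p q r = mk≈ λ k → begin
    coeff ((p ⊗ q) ⊗ r) k                             ≡⟨ coeff-⊗ (p ⊗ q) r k ⟩
    conv (coeff (p ⊗ q)) (coeff r) k                  ≡⟨ conv-cong (coeff-⊗ p q) (λ _ → refl) k ⟩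
    conv (conv (coeff p) (coeff q)) (coeff r) k       ≡⟨ conv-assoc (coeff p) (coeff q) (coeff r) k ⟩
    conv (coeff p) (conv (coeff q) (coeff r)) k       ≡⟨ conv-cong (λ _ → refl) (coeff-⊗ q r) k ⟨
    conv (coeff p) (coeff (q ⊗ r)) k                  ≡⟨ coeff-⊗ p (q ⊗ r) k ⟨
    coeff (p ⊗ (q ⊗ r)) k                             ∎
    where open ≡-Reasoning

  ⊗-comm : ∀ p q → p ⊗ q ≈ q ⊗ p
  ⊗-comm p q = mk≈ λ k →
    trans (coeff-⊗ p q k) (trans (conv-comm (coeff p) (coeff q) k) (sym (coeff-⊗ q p k)))

  ⊗-identityˡ : ∀ p → one ⊗ p ≈ p
  ⊗-identityˡ p = mk≈ λ k → trans (coeff-⊗ one p k) (conv-identityˡ (coeff p) k)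

  ⊗-identityʳ : ∀ p → p ⊗ one ≈ p
  ⊗-identityʳ p = ≈-trans (⊗-comm p one) (⊗-identityˡ p)

  ⊗-distribˡ-⊕ : ∀ p q r → p ⊗ (q ⊕ r) ≈ (p ⊗ q) ⊕ (p ⊗ r)
  ⊗-distribˡ-⊕ p q r = mk≈ λ k → begin
    coeff (p ⊗ (q ⊕ r)) k                                        ≡⟨ coeff-⊗ p (q ⊕ r) k ⟩
    conv (coeff p) (coeff (q ⊕ r)) k                             ≡⟨ conv-cong (λ _ → refl) (coeff-⊕ q r) k ⟩
    conv (coeff p) (λ i → coeff q i + coeff r i) k               ≡⟨ conv-distribˡ (coeff p) (coeff q) (coeff r) k ⟩
    conv (coeff p) (coeff q) k + conv (coeff p) (coeff r) k      ≡⟨ cong₂ _+_ (coeff-⊗ p q k) (coeff-⊗ p r k) ⟨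
    coeff (p ⊗ q) k + coeff (p ⊗ r) k                            ≡⟨ coeff-⊕ (p ⊗ q) (p ⊗ r) k ⟨
    coeff ((p ⊗ q) ⊕ (p ⊗ r)) k                                  ∎
    where open ≡-Reasoning

  ⊗-distribʳ-⊕ : ∀ p q r → (q ⊕ r) ⊗ p ≈ (q ⊗ p) ⊕ (r ⊗ p)
  ⊗-distribʳ-⊕ p q r =
    ≈-trans (⊗-comm (q ⊕ r) p) (≈-trans (⊗-distribˡ-⊕ p q r) (⊕-cong (⊗-comm p q) (⊗-comm p r)))

  polyCommutativeRing : CommutativeRing 0ℓ 0ℓ
  polyCommutativeRing = record
    { Carrier = Poly ; _≈_ = _≈_ ; _+_ = _⊕_ ; _*_ = _⊗_ ; -_ = ⊖_ ; 0# = [] ; 1# = one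
    ; isCommutativeRing = record
      { isRing = record
        { +-isAbelianGroup = record
          { isGroup = record
            { isMonoid = record
              { isSemigroup = record
                { isMagma = record
                  { isEquivalence = record { refl = ≈-refl ; sym = ≈-sym ; trans = ≈-trans }
                  ; ∙-cong = ⊕-cong }
                ; assoc = ⊕-assoc }
              ; identity = (λ _ → ≈-refl) , ⊕-identityʳ }
            ; inverse = ⊕-inverseˡ , ⊕-inverseʳ
            ; ⁻¹-cong = ⊖-cong }
          ; comm = ⊕-comm }
        ; *-cong = ⊗-cong
        ; *-assoc = ⊗-assoc
        ; *-identity = ⊗-identityˡ , ⊗-identityʳ
        ; distrib = ⊗-distribˡ-⊕ , ⊗-distribʳ-⊕ }
      ; *-comm = ⊗-comm }
    }

  []≈? : (p : Poly) → Maybe ([] ≈ p)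
  []≈? []            = just ≈-refl
  []≈? (+ zero ∷ p) with []≈? p
  ... | just e  = just (mk≈ λ { zero → refl ; (suc k) → coeff-≡ e k })
  ... | nothing = nothing
  []≈? (_ ∷ p)       = nothing

  module PolySolver = NonReflective (ACR.fromCommutativeRing polyCommutativeRing []≈?)
  open PolySolver using (solve; _⊜_; Κ) renaming (_⊕_ to _⊞_; _⊗_ to _⊠_; ⊝_ to ⊟_)

  polySetoid : Setoid 0ℓ 0ℓ
  polySetoid = CommutativeRing.setoid polyCommutativeRing

  ⊗-zeroʳ : ∀ p → p ⊗ [] ≈ []
  ⊗-zeroʳ p = ⊗-comm p []

  κ : ℤ → Poly
  κ a = a ∷ []

  X : Poly
  X = 0ℤ ∷ 1ℤ ∷ []

  linear : ℤ → ℤ → Poly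
  linear a b = a ∷ b ∷ []

  monomial : ℕ → Poly
  monomial zero    = one
  monomial (suc n) = X ⊗ monomial n

  κ⊗≈scale : ∀ a p → κ a ⊗ p ≈ scale a p
  κ⊗≈scale a p = mk≈ λ k → trans (coeff-⊕ (scale a p) (0ℤ ∷ []) k) (trans (cong (λ z → coeff (scale a p) k + z) (coeff-zero k)) (ℤₚ.+-identityʳ _))
    where coeff-zero : ∀ k → coeff (0ℤ ∷ []) k ≡ 0ℤ
          coeff-zero zero    = refl
          coeff-zero (suc k) = refl

  coeff-κ⊗ : ∀ a p k → coeff (κ a ⊗ p) k ≡ a * coeff p k
  coeff-κ⊗ a p k = trans (coeff-≡ (κ⊗≈scale a p) k) (coeff-scale a p k)

  κ-+ : ∀ a b → κ (a + b) ≈ κ a ⊕ κ b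
  κ-+ a b = mk≈ λ { zero → refl ; (suc k) → refl }

  κ-* : ∀ a b → κ (a * b) ≈ κ a ⊗ κ b
  κ-* a b = ≈-sym (κ⊗≈scale a (κ b))

  κ-0 : κ 0ℤ ≈ []
  κ-0 = mk≈ λ { zero → refl ; (suc k) → refl }

  κ-minus : ∀ a b → κ (a - b) ≈ κ a ⊕ ⊖ κ b
  κ-minus a b = mk≈ λ { zero → cong (_+_ a) (sym (ℤₚ.-1*i≡-i b)) ; (suc k) → refl }

  κ-2*2* : ∀ μ → κ (+ 2 * (+ 2 * μ)) ≈ κ (+ 2) ⊗ (κ (+ 2) ⊗ κ μ)
  κ-2*2* μ = ≈-trans (κ-* (+ 2) (+ 2 * μ)) (⊗-cong (≈-refl {κ (+ 2)}) (κ-* (+ 2) μ))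

  linear-≈ : ∀ a b → linear a b ≈ κ a ⊕ (κ b ⊗ X)
  linear-≈ a b = mk≈ λ
    { 0             → sym (trans (cong (_+_ a) (trans (ℤₚ.+-identityʳ _) (ℤₚ.*-zeroʳ b))) (ℤₚ.+-identityʳ a))
    ; 1             → sym (ℤₚ.*-identityʳ b)
    ; (suc (suc k)) → refl }

  coeff-linear⊗ : ∀ a b p k → coeff (linear a b ⊗ p) (suc k) ≡ a * coeff p (suc k) + b * coeff p k
  coeff-linear⊗ a b p k = trans (coeff-⊗ (linear a b) p (suc k))
    (cong (λ z → a * coeff p (suc k) + z) (trans (sym (coeff-⊗ (κ b) p k)) (coeff-κ⊗ b p k)))

  coeff-X⊗ : ∀ p k → coeff (X ⊗ p) (suc k) ≡ coeff p k
  coeff-X⊗ p k = trans (coeff-linear⊗ 0ℤ 1ℤ p k) (trans (ℤₚ.+-identityˡ _) (ℤₚ.*-identityˡ _))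

  coeff-monomial⊗ : ∀ n p k → coeff (monomial n ⊗ p) (n ℕ.+ k) ≡ coeff p k
  coeff-monomial⊗ zero    p k = coeff-≡ (⊗-identityˡ p) k
  coeff-monomial⊗ (suc n) p k = begin
    coeff ((X ⊗ monomial n) ⊗ p) (suc n ℕ.+ k) ≡⟨ coeff-≡ (⊗-assoc X (monomial n) p) (suc n ℕ.+ k) ⟩
    coeff (X ⊗ (monomial n ⊗ p)) (suc n ℕ.+ k) ≡⟨ coeff-X⊗ (monomial n ⊗ p) (n ℕ.+ k) ⟩
    coeff (monomial n ⊗ p) (n ℕ.+ k)           ≡⟨ coeff-monomial⊗ n p k ⟩
    coeff p k                                   ∎
    where open ≡-Reasoning

  coeff-monomial-self : ∀ n → coeff (monomial n) n ≡ 1ℤ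
  coeff-monomial-self zero    = refl
  coeff-monomial-self (suc n) = trans (coeff-X⊗ (monomial n) n) (coeff-monomial-self n)

  coeff-monomial-≢ : ∀ n k → k ≢ n → coeff (monomial n) k ≡ 0ℤ
  coeff-monomial-≢ zero    zero    k≢n = contradiction refl k≢n
  coeff-monomial-≢ zero    (suc k) k≢n = refl
  coeff-monomial-≢ (suc n) zero    k≢n = coeff-⊗ X (monomial n) 0
  coeff-monomial-≢ (suc n) (suc k) k≢n =
    trans (coeff-X⊗ (monomial n) k) (coeff-monomial-≢ n k (k≢n ∘ cong suc))

  monomial-+ : ∀ a b → monomial (a ℕ.+ b) ≈ monomial a ⊗ monomial b
  monomial-+ zero    b = ≈-sym (⊗-identityˡ (monomial b))
  monomial-+ (suc a) b = ≈-trans (⊗-cong (≈-refl {X}) (monomial-+ a b)) (≈-sym (⊗-assoc X (monomial a) (monomial b)))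

  coeff-beyond-length : ∀ p k → length p ℕ.≤ k → coeff p k ≡ 0ℤ
  coeff-beyond-length []      k       _           = refl
  coeff-beyond-length (a ∷ p) (suc k) (s≤s len≤k) = coeff-beyond-length p k len≤k

  -- Integer arithmetic and congruences

  2*≡+ : ∀ n → 2 ℕ.* n ≡ n ℕ.+ n
  2*≡+ n = cong (n ℕ.+_) (ℕₚ.+-identityʳ n)

  pos-∸ : ∀ {m n} → n ℕ.≤ m → + (m ℕ.∸ n) ≡ + m - + n
  pos-∸ {m} {n} n≤m = sym (trans (ℤₚ.m-n≡m⊖n m n) (ℤₚ.⊖-≥ n≤m))

  pos-2*2* : ∀ n → + (2 ℕ.* (2 ℕ.* n)) ≡ + 2 * (+ 2 * + n)
  pos-2*2* n = trans (ℤₚ.pos-* 2 (2 ℕ.* n)) (cong (+ 2 *_) (ℤₚ.pos-* 2 n))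

  2∣n[n+1] : ∀ n → + 2 ∣ + n * (+ n + 1ℤ)
  2∣n[n+1] zero    = divides 0ℤ refl
  2∣n[n+1] (suc n) = subst (+ 2 ∣_) (step (+ n)) (∣m∣n⇒∣m+n (2∣n[n+1] n) (divides (+ n + 1ℤ) refl))
    where step : ∀ x → x * (x + 1ℤ) + (x + 1ℤ) * + 2 ≡ (1ℤ + x) * ((1ℤ + x) + 1ℤ)
          step = solve-∀

  2∣t[t+1] : ∀ t → + 2 ∣ t * (t + 1ℤ)
  2∣t[t+1] (+ n)    = 2∣n[n+1] n
  2∣t[t+1] -[1+ n ] = subst (+ 2 ∣_) (reflect (+ n)) (2∣n[n+1] n)
    where reflect : ∀ x → x * (x + 1ℤ) ≡ (- (1ℤ + x)) * (- (1ℤ + x) + 1ℤ)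
          reflect = solve-∀

  infix 4 _≡_⟨mod_⟩ _≈_⟨mod_⟩

  record _≡_⟨mod_⟩ (a b m : ℤ) : Set where
    constructor ∣⇒≡mod
    field ≡mod⇒∣ : m ∣ a - b
  open _≡_⟨mod_⟩ public

  ≡mod-by : ∀ {a b m} t → a - b ≡ t * m → a ≡ b ⟨mod m ⟩
  ≡mod-by t e = ∣⇒≡mod (divides t e)

  ≡⇒≡mod : ∀ {a b m} → a ≡ b → a ≡ b ⟨mod m ⟩
  ≡⇒≡mod {a} refl = ≡mod-by 0ℤ (ℤₚ.+-inverseʳ a)

  ≡mod-refl : ∀ {m} a → a ≡ a ⟨mod m ⟩
  ≡mod-refl a = ≡⇒≡mod refl

  ≡mod-sym : ∀ {a b m} → a ≡ b ⟨mod m ⟩ → b ≡ a ⟨mod m ⟩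
  ≡mod-sym {a} {b} {m} (∣⇒≡mod m∣a-b) = ∣⇒≡mod (subst (m ∣_) (identity a b) (∣m⇒∣-m m∣a-b))
    where identity : ∀ a b → - (a - b) ≡ b - a
          identity = solve-∀

  ≡mod-trans : ∀ {a b c m} → a ≡ b ⟨mod m ⟩ → b ≡ c ⟨mod m ⟩ → a ≡ c ⟨mod m ⟩
  ≡mod-trans {a} {b} {c} {m} (∣⇒≡mod m∣a-b) (∣⇒≡mod m∣b-c) =
    ∣⇒≡mod (subst (m ∣_) (identity a b c) (∣m∣n⇒∣m+n m∣a-b m∣b-c))
    where identity : ∀ a b c → (a - b) + (b - c) ≡ a - c
          identity = solve-∀

  ≡mod-neg : ∀ {a b m} → a ≡ b ⟨mod m ⟩ → - a ≡ - b ⟨mod m ⟩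
  ≡mod-neg {a} {b} {m} (∣⇒≡mod m∣a-b) = ∣⇒≡mod (subst (m ∣_) (identity a b) (∣m⇒∣-m m∣a-b))
    where identity : ∀ a b → - (a - b) ≡ - a - - b
          identity = solve-∀

  ≡mod-modulus : ∀ {a b m m′} → m ≡ m′ → a ≡ b ⟨mod m ⟩ → a ≡ b ⟨mod m′ ⟩
  ≡mod-modulus refl a≡b = a≡b

  ≡mod-setoid : ℤ → Setoid 0ℓ 0ℓ
  ≡mod-setoid m = record
    { Carrier = ℤ ; _≈_ = λ a b → a ≡ b ⟨mod m ⟩
    ; isEquivalence = record { refl = ≡mod-refl _ ; sym = ≡mod-sym ; trans = ≡mod-trans } }

  ≡mod-+ : ∀ {a b c d m} → a ≡ b ⟨mod m ⟩ → c ≡ d ⟨mod m ⟩ → a + c ≡ b + d ⟨mod m ⟩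
  ≡mod-+ {a} {b} {c} {d} {m} (∣⇒≡mod m∣a-b) (∣⇒≡mod m∣c-d) =
    ∣⇒≡mod (subst (m ∣_) (identity a b c d) (∣m∣n⇒∣m+n m∣a-b m∣c-d))
    where identity : ∀ a b c d → (a - b) + (c - d) ≡ (a + c) - (b + d)
          identity = solve-∀

  ≡mod-scale : ∀ {a b m} c → a ≡ b ⟨mod m ⟩ → c * a ≡ c * b ⟨mod c * m ⟩
  ≡mod-scale {a} {b} {m} c (∣⇒≡mod (divides t a-b≡tm)) = ≡mod-by t (begin
    c * a - c * b   ≡⟨ identity c a b ⟩
    c * (a - b)     ≡⟨ cong (c *_) a-b≡tm ⟩
    c * (t * m)     ≡⟨ identity′ c t m ⟩
    t * (c * m)     ∎)
    where open ≡-Reasoning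
          identity : ∀ c a b → c * a - c * b ≡ c * (a - b)
          identity = solve-∀
          identity′ : ∀ c t m → c * (t * m) ≡ t * (c * m)
          identity′ = solve-∀

  ≡mod-halve : ∀ {a b} m → a ≡ b ⟨mod + 2 * m ⟩ → a ≡ b ⟨mod m ⟩
  ≡mod-halve m (∣⇒≡mod 2m∣a-b) = ∣⇒≡mod (∣-trans (divides (+ 2) refl) 2m∣a-b)

  ≡mod-cancel-double : ∀ {a b c} m → b + + 2 * a ≡ c ⟨mod + 2 * m ⟩ → a ≡ 0ℤ ⟨mod m ⟩ → b ≡ c ⟨mod + 2 * m ⟩
  ≡mod-cancel-double {a} {b} {c} m (∣⇒≡mod 2m∣b+2a-c) (∣⇒≡mod m∣a-0) =
    ∣⇒≡mod (subst (+ 2 * m ∣_) (identity a b c) (∣m∣n⇒∣m-n 2m∣b+2a-c (*-monoʳ-∣ (+ 2) m∣a-0)))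
    where identity : ∀ a b c → (b + + 2 * a - c) - + 2 * (a - 0ℤ) ≡ b - c
          identity = solve-∀

  ≡mod-odd-multiple : ∀ M {e} → e ≡ 1ℤ ⟨mod + 2 ⟩ → + M * e ≡ + M ⟨mod + (2 ℕ.* M) ⟩
  ≡mod-odd-multiple M {e} e≡1 = subst₂ (λ a n → + M * e ≡ a ⟨mod n ⟩) (ℤₚ.*-identityʳ (+ M))
    (trans (ℤₚ.*-comm (+ M) (+ 2)) (sym (ℤₚ.pos-* 2 M))) (≡mod-scale (+ M) e≡1)

  -- Polynomial congruences

  record _≈_⟨mod_⟩ (p q : Poly) (m : ℤ) : Set where
    constructor congruent
    field
      quotient : Poly
      equality : p ≈ q ⊕ (κ m ⊗ quotient)

  ≈⇒≈mod : ∀ {p q m} → p ≈ q → p ≈ q ⟨mod m ⟩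
  ≈⇒≈mod {p} {q} {m} p≈q = congruent [] (≈-trans p≈q (≈-sym (≈-trans (⊕-cong ≈-refl (⊗-zeroʳ (κ m))) (⊕-identityʳ q))))

  ≈mod-refl : ∀ {p m} → p ≈ p ⟨mod m ⟩
  ≈mod-refl = ≈⇒≈mod ≈-refl

  ≈mod-sym : ∀ {p q m} → p ≈ q ⟨mod m ⟩ → q ≈ p ⟨mod m ⟩
  ≈mod-sym {p} {q} {m} (congruent r p≈q+mr) = congruent (⊖ r) (begin
    q                                    ≈⟨ solve 3 (λ q c r → q ⊜ ((q ⊞ (c ⊠ r)) ⊞ (c ⊠ (⊟ r)))) ≈-refl q (κ m) r ⟩
    (q ⊕ (κ m ⊗ r)) ⊕ (κ m ⊗ (⊖ r))      ≈⟨ ⊕-cong (≈-sym p≈q+mr) (≈-refl {κ m ⊗ (⊖ r)}) ⟩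
    p ⊕ (κ m ⊗ (⊖ r))                    ∎)
    where open SetoidReasoning polySetoid

  ≈mod-trans : ∀ {p q s m} → p ≈ q ⟨mod m ⟩ → q ≈ s ⟨mod m ⟩ → p ≈ s ⟨mod m ⟩
  ≈mod-trans {p} {q} {s} {m} (congruent r p≈q+mr) (congruent r′ q≈s+mr′) = congruent (r ⊕ r′) (begin
    p                                       ≈⟨ p≈q+mr ⟩
    q ⊕ (κ m ⊗ r)                           ≈⟨ ⊕-cong q≈s+mr′ (≈-refl {κ m ⊗ r}) ⟩
    (s ⊕ (κ m ⊗ r′)) ⊕ (κ m ⊗ r)            ≈⟨ solve 4 (λ s c r r′ → ((s ⊞ (c ⊠ r′)) ⊞ (c ⊠ r)) ⊜ (s ⊞ (c ⊠ (r ⊞ r′)))) ≈-refl s (κ m) r r′ ⟩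
    s ⊕ (κ m ⊗ (r ⊕ r′))                    ∎)
    where open SetoidReasoning polySetoid

  ≈mod-setoid : ℤ → Setoid 0ℓ 0ℓ
  ≈mod-setoid m = record
    { Carrier = Poly ; _≈_ = λ p q → p ≈ q ⟨mod m ⟩
    ; isEquivalence = record { refl = ≈mod-refl ; sym = ≈mod-sym ; trans = ≈mod-trans } }

  ≈mod-⊕ : ∀ {p p′ q q′ m} → p ≈ p′ ⟨mod m ⟩ → q ≈ q′ ⟨mod m ⟩ → p ⊕ q ≈ p′ ⊕ q′ ⟨mod m ⟩
  ≈mod-⊕ {p} {p′} {q} {q′} {m} (congruent r p≈) (congruent s q≈) = congruent (r ⊕ s)
    (≈-trans (⊕-cong p≈ q≈) (solve 5 (λ p q c r s → ((p ⊞ (c ⊠ r)) ⊞ (q ⊞ (c ⊠ s))) ⊜ ((p ⊞ q) ⊞ (c ⊠ (r ⊞ s)))) ≈-refl p′ q′ (κ m) r s))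

  ≈mod-⊗ : ∀ {p p′ q q′ m} → p ≈ p′ ⟨mod m ⟩ → q ≈ q′ ⟨mod m ⟩ → p ⊗ q ≈ p′ ⊗ q′ ⟨mod m ⟩
  ≈mod-⊗ {p} {p′} {q} {q′} {m} (congruent r p≈) (congruent s q≈) = congruent ((r ⊗ q′) ⊕ ((p′ ⊗ s) ⊕ (κ m ⊗ (r ⊗ s))))
    (≈-trans (⊗-cong p≈ q≈) (solve 5 (λ p q c r s → ((p ⊞ (c ⊠ r)) ⊠ (q ⊞ (c ⊠ s)))
                                                    ⊜ ((p ⊠ q) ⊞ (c ⊠ ((r ⊠ q) ⊞ ((p ⊠ s) ⊞ (c ⊠ (r ⊠ s)))))))
                                     ≈-refl p′ q′ (κ m) r s))

  ≈mod-κ⊗ : ∀ {p q m} c → p ≈ q ⟨mod m ⟩ → κ c ⊗ p ≈ κ c ⊗ q ⟨mod c * m ⟩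
  ≈mod-κ⊗ {p} {q} {m} c (congruent r p≈) = congruent r (begin
    κ c ⊗ p                         ≈⟨ ⊗-cong (≈-refl {κ c}) p≈ ⟩
    κ c ⊗ (q ⊕ (κ m ⊗ r))           ≈⟨ solve 4 (λ c q m r → (c ⊠ (q ⊞ (m ⊠ r))) ⊜ ((c ⊠ q) ⊞ ((c ⊠ m) ⊠ r))) ≈-refl (κ c) q (κ m) r ⟩
    (κ c ⊗ q) ⊕ ((κ c ⊗ κ m) ⊗ r)   ≈⟨ ⊕-cong (≈-refl {κ c ⊗ q}) (⊗-cong (≈-sym (κ-* c m)) (≈-refl {r})) ⟩
    (κ c ⊗ q) ⊕ (κ (c * m) ⊗ r)     ∎)
    where open SetoidReasoning polySetoid

  ≈mod-modulus : ∀ {p q m m′} → m ≡ m′ → p ≈ q ⟨mod m ⟩ → p ≈ q ⟨mod m′ ⟩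
  ≈mod-modulus refl p≈q = p≈q

  ≈mod⇒coeff : ∀ {p q m} → p ≈ q ⟨mod m ⟩ → ∀ k → coeff p k ≡ coeff q k ⟨mod m ⟩
  ≈mod⇒coeff {p} {q} {m} (congruent r p≈) k = ≡mod-by (coeff r k) (begin
    coeff p k - coeff q k                           ≡⟨ cong (_- coeff q k) (coeff-≡ p≈ k) ⟩
    coeff (q ⊕ (κ m ⊗ r)) k - coeff q k             ≡⟨ cong (_- coeff q k) (trans (coeff-⊕ q _ k) (cong (_+_ (coeff q k)) (coeff-κ⊗ m r k))) ⟩
    coeff q k + m * coeff r k - coeff q k           ≡⟨ identity (coeff q k) m (coeff r k) ⟩
    coeff r k * m                                   ∎)
    where open ≡-Reasoning
          identity : ∀ a m b → a + m * b - a ≡ b * m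
          identity = solve-∀

  κ-≈mod : ∀ {a b m} → a ≡ b ⟨mod m ⟩ → κ a ≈ κ b ⟨mod m ⟩
  κ-≈mod {a} {b} {m} (∣⇒≡mod (divides t a-b≡tm)) = congruent (κ t) (mk≈ λ
    { 0       → begin
        a                 ≡⟨ solveℤ (a ∷ b ∷ []) ⟩
        b + (a - b)       ≡⟨ cong (_+_ b) (trans a-b≡tm (ℤₚ.*-comm t m)) ⟩
        b + m * t         ≡⟨ cong (_+_ b) (ℤₚ.+-identityʳ _) ⟨
        b + (m * t + 0ℤ)  ∎
    ; (suc k) → refl })
    where open ≡-Reasoning

  linear-≈mod : ∀ {a a′ b b′ m} → a ≡ a′ ⟨mod m ⟩ → b ≡ b′ ⟨mod m ⟩ → linear a b ≈ linear a′ b′ ⟨mod m ⟩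
  linear-≈mod {a} {a′} {b} {b′} {m} (∣⇒≡mod (divides s a-a′≡sm)) (∣⇒≡mod (divides t b-b′≡tm)) =
    congruent (linear s t) (mk≈ λ
      { 0             → trans (difference⇒sum a a′ s a-a′≡sm) (cong (_+_ a′) (sym (ℤₚ.+-identityʳ _)))
      ; 1             → difference⇒sum b b′ t b-b′≡tm
      ; (suc (suc k)) → refl })
    where difference⇒sum : ∀ a a′ s → a - a′ ≡ s * m → a ≡ a′ + m * s
          difference⇒sum a a′ s a-a′≡sm = begin
            a               ≡⟨ solveℤ (a ∷ a′ ∷ []) ⟩
            a′ + (a - a′)   ≡⟨ cong (_+_ a′) a-a′≡sm ⟩
            a′ + s * m      ≡⟨ cong (_+_ a′) (ℤₚ.*-comm s m) ⟩
            a′ + m * s      ∎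
            where open ≡-Reasoning

  κ⊗≈mod[] : ∀ m r → κ m ⊗ r ≈ [] ⟨mod m ⟩
  κ⊗≈mod[] m r = congruent r ≈-refl

  square≈mod[] : ∀ μ Z → κ (+ 2 * μ) ⊗ (κ (+ 2 * μ) ⊗ Z) ≈ [] ⟨mod + 2 * (+ 2 * μ) ⟩
  square≈mod[] μ Z = ≈mod-trans (≈⇒≈mod (begin
    κ (+ 2 * μ) ⊗ (κ (+ 2 * μ) ⊗ Z)                  ≈⟨ ⊗-cong (κ-* (+ 2) μ) (⊗-cong (κ-* (+ 2) μ) (≈-refl {Z})) ⟩
    (κ (+ 2) ⊗ κ μ) ⊗ ((κ (+ 2) ⊗ κ μ) ⊗ Z)
      ≈⟨ solve 3 (λ t u z → ((t ⊠ u) ⊠ ((t ⊠ u) ⊠ z)) ⊜ ((t ⊠ (t ⊠ u)) ⊠ (u ⊠ z))) ≈-refl (κ (+ 2)) (κ μ) Z ⟩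
    (κ (+ 2) ⊗ (κ (+ 2) ⊗ κ μ)) ⊗ (κ μ ⊗ Z)          ≈⟨ ⊗-cong (≈-sym (κ-2*2* μ)) (≈-refl {κ μ ⊗ Z}) ⟩
    κ (+ 2 * (+ 2 * μ)) ⊗ (κ μ ⊗ Z)                  ∎))
    (κ⊗≈mod[] (+ 2 * (+ 2 * μ)) (κ μ ⊗ Z))
    where open SetoidReasoning polySetoid

  ≈mod-square : ∀ {p q} μ → p ≈ q ⟨mod + 2 * μ ⟩ → p ⊗ p ≈ q ⊗ q ⟨mod + 2 * (+ 2 * μ) ⟩
  ≈mod-square {p} {q} μ (congruent r p≈) = congruent ((q ⊗ r) ⊕ (κ μ ⊗ (r ⊗ r))) (begin
    p ⊗ p
      ≈⟨ ⊗-cong p′≈ p′≈ ⟩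
    (q ⊕ ((κ (+ 2) ⊗ κ μ) ⊗ r)) ⊗ (q ⊕ ((κ (+ 2) ⊗ κ μ) ⊗ r))
      ≈⟨ solve 3 (λ q u r → ((q ⊞ ((Κ (κ (+ 2)) ⊠ u) ⊠ r)) ⊠ (q ⊞ ((Κ (κ (+ 2)) ⊠ u) ⊠ r)))
                           ⊜ ((q ⊠ q) ⊞ ((Κ (κ (+ 2)) ⊠ (Κ (κ (+ 2)) ⊠ u)) ⊠ ((q ⊠ r) ⊞ (u ⊠ (r ⊠ r)))))) ≈-refl q (κ μ) r ⟩
    (q ⊗ q) ⊕ ((κ (+ 2) ⊗ (κ (+ 2) ⊗ κ μ)) ⊗ ((q ⊗ r) ⊕ (κ μ ⊗ (r ⊗ r))))
      ≈⟨ ⊕-cong (≈-refl {q ⊗ q}) (⊗-cong (≈-sym (κ-2*2* μ)) ≈-refl) ⟩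
    (q ⊗ q) ⊕ (κ (+ 2 * (+ 2 * μ)) ⊗ ((q ⊗ r) ⊕ (κ μ ⊗ (r ⊗ r)))) ∎)
    where
    open SetoidReasoning polySetoid
    p′≈ : p ≈ q ⊕ ((κ (+ 2) ⊗ κ μ) ⊗ r)
    p′≈ = ≈-trans p≈ (⊕-cong (≈-refl {q}) (⊗-cong (κ-* (+ 2) μ) (≈-refl {r})))

  -- The first-order term 2μ E (h₁ + h₂) vanishes modulo 4μ because h₁ + h₂ ≡ 2T ≡ 0 (mod 2).
  ≈mod-perturbed-pair : ∀ {h₁ h₂ T} μ E → h₁ ≈ T ⟨mod + 2 ⟩ → h₂ ≈ T ⟨mod + 2 ⟩ →
    (h₁ ⊕ (κ (+ 2 * μ) ⊗ E)) ⊗ (h₂ ⊕ (κ (+ 2 * μ) ⊗ E)) ≈ h₁ ⊗ h₂ ⟨mod + 2 * (+ 2 * μ) ⟩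
  ≈mod-perturbed-pair {h₁} {h₂} {T} μ E (congruent r₁ h₁≈) (congruent r₂ h₂≈) =
    congruent ((E ⊗ (T ⊕ (r₁ ⊕ r₂))) ⊕ (κ μ ⊗ (E ⊗ E))) (begin
    (h₁ ⊕ (κ (+ 2 * μ) ⊗ E)) ⊗ (h₂ ⊕ (κ (+ 2 * μ) ⊗ E))
      ≈⟨ ⊗-cong (⊕-cong h₁≈ 2μE≈) (⊕-cong h₂≈ 2μE≈) ⟩
    ((T ⊕ (two ⊗ r₁)) ⊕ ((two ⊗ κ μ) ⊗ E)) ⊗ ((T ⊕ (two ⊗ r₂)) ⊕ ((two ⊗ κ μ) ⊗ E))
      ≈⟨ solve 5 (λ T r₁ r₂ u E →
           (((T ⊞ (Κ two ⊠ r₁)) ⊞ ((Κ two ⊠ u) ⊠ E)) ⊠ ((T ⊞ (Κ two ⊠ r₂)) ⊞ ((Κ two ⊠ u) ⊠ E)))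
           ⊜ (((T ⊞ (Κ two ⊠ r₁)) ⊠ (T ⊞ (Κ two ⊠ r₂))) ⊞ ((Κ two ⊠ (Κ two ⊠ u)) ⊠ ((E ⊠ (T ⊞ (r₁ ⊞ r₂))) ⊞ (u ⊠ (E ⊠ E))))))
           ≈-refl T r₁ r₂ (κ μ) E ⟩
    ((T ⊕ (two ⊗ r₁)) ⊗ (T ⊕ (two ⊗ r₂))) ⊕ ((two ⊗ (two ⊗ κ μ)) ⊗ ((E ⊗ (T ⊕ (r₁ ⊕ r₂))) ⊕ (κ μ ⊗ (E ⊗ E))))
      ≈⟨ ⊕-cong (⊗-cong (≈-sym h₁≈) (≈-sym h₂≈)) (⊗-cong (≈-sym (κ-2*2* μ)) ≈-refl) ⟩
    (h₁ ⊗ h₂) ⊕ (κ (+ 2 * (+ 2 * μ)) ⊗ ((E ⊗ (T ⊕ (r₁ ⊕ r₂))) ⊕ (κ μ ⊗ (E ⊗ E)))) ∎)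
    where
    open SetoidReasoning polySetoid
    two = κ (+ 2)
    2μE≈ : κ (+ 2 * μ) ⊗ E ≈ (two ⊗ κ μ) ⊗ E
    2μE≈ = ⊗-cong (κ-* (+ 2) μ) (≈-refl {E})

  -- Products over windows of consecutive indices

  window : (ℤ → Poly) → ℤ → ℕ → Poly
  window g b zero    = one
  window g b (suc n) = g b ⊗ window g (b + 1ℤ) n

  window-≈mod : ∀ {g h m} → (∀ β → g β ≈ h β ⟨mod m ⟩) → ∀ b n → window g b n ≈ window h b n ⟨mod m ⟩
  window-≈mod g≈h b zero    = ≈mod-refl
  window-≈mod g≈h b (suc n) = ≈mod-⊗ (g≈h b) (window-≈mod g≈h (b + 1ℤ) n)

  window-+ : ∀ g b n₁ n₂ → window g b (n₁ ℕ.+ n₂) ≈ window g b n₁ ⊗ window g (b + + n₁) n₂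
  window-+ g b zero     n₂ = ≈-trans (≈-reflexive (cong (λ c → window g c n₂) (sym (ℤₚ.+-identityʳ b)))) (≈-sym (⊗-identityˡ _))
  window-+ g b (suc n₁) n₂ = begin
    g b ⊗ window g (b + 1ℤ) (n₁ ℕ.+ n₂)                               ≈⟨ ⊗-cong (≈-refl {g b}) (window-+ g (b + 1ℤ) n₁ n₂) ⟩
    g b ⊗ (window g (b + 1ℤ) n₁ ⊗ window g (b + 1ℤ + + n₁) n₂)       ≈⟨ ≈-sym (⊗-assoc (g b) _ _) ⟩
    (g b ⊗ window g (b + 1ℤ) n₁) ⊗ window g (b + 1ℤ + + n₁) n₂
      ≡⟨ cong (λ c → (g b ⊗ window g (b + 1ℤ) n₁) ⊗ window g c n₂) (ℤₚ.+-assoc b 1ℤ (+ n₁)) ⟩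
    (g b ⊗ window g (b + 1ℤ) n₁) ⊗ window g (b + + suc n₁) n₂        ∎
    where open SetoidReasoning polySetoid

  window-shift : ∀ g d b n → window g (b + d) n ≈ window (λ β → g (β + d)) b n
  window-shift g d b zero    = ≈-refl
  window-shift g d b (suc n) = ⊗-cong (≈-refl {g (b + d)}) (begin
    window g (b + d + 1ℤ) n                 ≡⟨ cong (λ c → window g c n) (solveℤ (b ∷ d ∷ [])) ⟩
    window g (b + 1ℤ + d) n                 ≈⟨ window-shift g d (b + 1ℤ) n ⟩
    window (λ β → g (β + d)) (b + 1ℤ) n     ∎)
    where open SetoidReasoning polySetoid

  window-⊗ : ∀ g h b n → window (λ β → g β ⊗ h β) b n ≈ window g b n ⊗ window h b n
  window-⊗ g h b zero    = ≈-sym (⊗-identityˡ one)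
  window-⊗ g h b (suc n) = ≈-trans (⊗-cong (≈-refl {g b ⊗ h b}) (window-⊗ g h (b + 1ℤ) n))
    (solve 4 (λ x y u v → ((x ⊠ y) ⊠ (u ⊠ v)) ⊜ ((x ⊠ u) ⊠ (y ⊠ v))) ≈-refl (g b) (h b) (window g (b + 1ℤ) n) (window h (b + 1ℤ) n))

  window-X : ∀ b n → window (λ _ → X) b n ≈ monomial n
  window-X b zero    = ≈-refl
  window-X b (suc n) = ⊗-cong (≈-refl {X}) (window-X (b + 1ℤ) n)

  window-pair : ∀ g b L → window g b (suc L ℕ.+ suc L) ≈ (g b ⊗ g (b + 1ℤ)) ⊗ window g (b + 1ℤ + 1ℤ) (L ℕ.+ L)
  window-pair g b L = ≈-trans
    (≈-reflexive (cong (λ n → g b ⊗ window g (b + 1ℤ) n) (ℕₚ.+-suc L L)))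
    (≈-sym (⊗-assoc (g b) (g (b + 1ℤ)) (window g (b + 1ℤ + 1ℤ) (L ℕ.+ L))))

  -- C is the sum of the first and last index, so each factor is paired with its mirror image.
  window-fold : ∀ g C b L → C ≡ b + b + + (L ℕ.+ L) - 1ℤ →
                window g b (L ℕ.+ L) ≈ window (λ γ → g γ ⊗ g (C - γ)) b L
  window-fold g C b zero    _ = ≈-refl
  window-fold g C b (suc L) C≡ = begin
    g b ⊗ window g (b + 1ℤ) (L ℕ.+ suc L)
      ≡⟨ cong (λ n → g b ⊗ window g (b + 1ℤ) n) (trans (ℕₚ.+-suc L L) (ℕₚ.+-comm 1 (L ℕ.+ L))) ⟩
    g b ⊗ window g (b + 1ℤ) ((L ℕ.+ L) ℕ.+ 1)                  ≈⟨ ⊗-cong (≈-refl {g b}) (window-+ g (b + 1ℤ) (L ℕ.+ L) 1) ⟩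
    g b ⊗ (window g (b + 1ℤ) (L ℕ.+ L) ⊗ (g (b + 1ℤ + + (L ℕ.+ L)) ⊗ one))
        ≈⟨ ⊗-cong (≈-refl {g b}) (⊗-cong (window-fold g C (b + 1ℤ) L C≡′) (⊗-cong (≈-reflexive (cong g last≡)) (≈-refl {one}))) ⟩
    g b ⊗ (window (λ γ → g γ ⊗ g (C - γ)) (b + 1ℤ) L ⊗ (g (C - b) ⊗ one))
        ≈⟨ solve 3 (λ x w y → (x ⊠ (w ⊠ (y ⊠ Κ one))) ⊜ ((x ⊠ y) ⊠ w)) ≈-refl (g b) _ (g (C - b)) ⟩
    (g b ⊗ g (C - b)) ⊗ window (λ γ → g γ ⊗ g (C - γ)) (b + 1ℤ) L ∎
    where
    open SetoidReasoning polySetoid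
    L+L = + (L ℕ.+ L)
    sucL+sucL : + (suc L ℕ.+ suc L) ≡ + 2 + L+L
    sucL+sucL = trans (cong (λ n → + suc n) (ℕₚ.+-suc L L)) (ℤₚ.pos-+ 2 (L ℕ.+ L))
    C≡′ : C ≡ (b + 1ℤ) + (b + 1ℤ) + L+L - 1ℤ
    C≡′ = trans C≡ (trans (cong (λ z → b + b + z - 1ℤ) sucL+sucL) (shift b L+L))
      where shift : ∀ b n → b + b + (+ 2 + n) - 1ℤ ≡ (b + 1ℤ) + (b + 1ℤ) + n - 1ℤ
            shift = solve-∀
    last≡ : b + 1ℤ + L+L ≡ C - b
    last≡ = sym (trans (cong (_- b) C≡′) (cancel b L+L))
      where cancel : ∀ b n → (b + 1ℤ) + (b + 1ℤ) + n - 1ℤ - b ≡ b + 1ℤ + n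
            cancel = solve-∀

  window-≈mod-perturbed : ∀ {g h} μ E T → (∀ γ → g γ ≈ h γ ⊕ (κ (+ 2 * μ) ⊗ E) ⟨mod + 2 * (+ 2 * μ) ⟩) →
    (∀ γ → h γ ≈ T ⟨mod + 2 ⟩) → ∀ b L → window g b (L ℕ.+ L) ≈ window h b (L ℕ.+ L) ⟨mod + 2 * (+ 2 * μ) ⟩
  window-≈mod-perturbed μ E T g≈ h≈ b zero    = ≈mod-refl
  window-≈mod-perturbed {g} {h} μ E T g≈ h≈ b (suc L) = begin
    window g b (suc L ℕ.+ suc L)                                           ≈⟨ ≈⇒≈mod (window-pair g b L) ⟩
    (g b ⊗ g (b + 1ℤ)) ⊗ window g (b + 1ℤ + 1ℤ) (L ℕ.+ L)                  ≈⟨ ≈mod-⊗ pair (window-≈mod-perturbed μ E T g≈ h≈ (b + 1ℤ + 1ℤ) L) ⟩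
    (h b ⊗ h (b + 1ℤ)) ⊗ window h (b + 1ℤ + 1ℤ) (L ℕ.+ L)                  ≈⟨ ≈⇒≈mod (≈-sym (window-pair h b L)) ⟩
    window h b (suc L ℕ.+ suc L)                                           ∎
    where
    open SetoidReasoning (≈mod-setoid (+ 2 * (+ 2 * μ)))
    pair : g b ⊗ g (b + 1ℤ) ≈ h b ⊗ h (b + 1ℤ) ⟨mod + 2 * (+ 2 * μ) ⟩
    pair = ≈mod-trans (≈mod-⊗ (g≈ b) (g≈ (b + 1ℤ))) (≈mod-perturbed-pair μ E (h≈ b) (h≈ (b + 1ℤ)))

  window-foldr : ∀ (F : ℕ → Poly) (G : ℤ → Poly) f b L → (∀ i → i ℕ.< L → F (f i) ≈ G (b + + i)) →
                 foldr (λ j acc → F j ⊗ acc) one (applyUpTo f L) ≈ window G b L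
  window-foldr F G f b zero    F≈G = ≈-refl
  window-foldr F G f b (suc L) F≈G = ⊗-cong
    (≈-trans (F≈G 0 (s≤s z≤n)) (≈-reflexive (cong G (ℤₚ.+-identityʳ b))))
    (window-foldr F G (f ∘ suc) (b + 1ℤ) L λ i i<L →
      ≈-trans (F≈G (suc i) (s≤s i<L)) (≈-reflexive (cong G (sym (ℤₚ.+-assoc b 1ℤ (+ i))))))

  -- The linear factors

  factorℤ : ℤ → ℤ → Poly
  factorℤ K β = linear (K - β) β

  pairedFactor : ℤ → ℤ → Poly
  pairedFactor K β = factorℤ K β ⊗ factorℤ K (K - β)

  Y : Poly
  Y = (one ⊕ (⊖ X)) ⊗ (one ⊕ (⊖ X))

  quadForm : ℤ → ℤ → Poly
  quadForm s w = (κ s ⊗ X) ⊕ (κ w ⊗ Y)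

  pairedFactor-≈ : ∀ K β → pairedFactor K β ≈ quadForm (K * K) (β * (K - β))
  pairedFactor-≈ K β = begin
    factorℤ K β ⊗ factorℤ K (K - β)
      ≈⟨ ⊗-cong (linear-≈ (K - β) β) (≈-trans (≈-reflexive (cong (λ a → linear a (K - β)) (K-[K-β]≡β K β))) (linear-≈ β (K - β))) ⟩
    (κ (K - β) ⊕ (κ β ⊗ X)) ⊗ (κ β ⊕ (κ (K - β) ⊗ X))
      ≈⟨ ⊗-cong (⊕-cong (κ-minus K β) (≈-refl {κ β ⊗ X})) (⊕-cong (≈-refl {κ β}) (⊗-cong (κ-minus K β) (≈-refl {X}))) ⟩
    ((κ K ⊕ (⊖ κ β)) ⊕ (κ β ⊗ X)) ⊗ (κ β ⊕ ((κ K ⊕ (⊖ κ β)) ⊗ X))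
      ≈⟨ solve 3 (λ k b x → (((k ⊞ (⊟ b)) ⊞ (b ⊠ x)) ⊠ (b ⊞ ((k ⊞ (⊟ b)) ⊠ x)))
                            ⊜ (((k ⊠ k) ⊠ x) ⊞ ((b ⊠ (k ⊞ (⊟ b))) ⊠ ((Κ one ⊞ (⊟ x)) ⊠ (Κ one ⊞ (⊟ x)))))) ≈-refl (κ K) (κ β) X ⟩
    ((κ K ⊗ κ K) ⊗ X) ⊕ ((κ β ⊗ (κ K ⊕ (⊖ κ β))) ⊗ Y)
      ≈⟨ ⊕-cong (⊗-cong (≈-sym (κ-* K K)) (≈-refl {X})) (⊗-cong (≈-sym (≈-trans (κ-* β (K - β)) (⊗-cong (≈-refl {κ β}) (κ-minus K β)))) (≈-refl {Y})) ⟩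
    quadForm (K * K) (β * (K - β)) ∎
    where open SetoidReasoning polySetoid
          K-[K-β]≡β : ∀ K β → K - (K - β) ≡ β
          K-[K-β]≡β = solve-∀

  quadForm-≈mod : ∀ {s s′ w w′ m} → s ≡ s′ ⟨mod m ⟩ → w ≡ w′ ⟨mod m ⟩ → quadForm s w ≈ quadForm s′ w′ ⟨mod m ⟩
  quadForm-≈mod s≡ w≡ = ≈mod-⊕ (≈mod-⊗ (κ-≈mod s≡) (≈mod-refl {X})) (≈mod-⊗ (κ-≈mod w≡) (≈mod-refl {Y}))

  quadForm-1-0 : quadForm 1ℤ 0ℤ ≈ X
  quadForm-1-0 = ≈-trans (⊕-cong (⊗-identityˡ X) (⊗-cong κ-0 (≈-refl {Y}))) (⊕-identityʳ X)

  quadForm-0-1 : quadForm 0ℤ 1ℤ ≈ Y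
  quadForm-0-1 = ≈-trans (⊕-cong (⊗-cong κ-0 (≈-refl {X})) (⊗-identityˡ Y)) ≈-refl

  quadForm-+ : ∀ s w s′ w′ → quadForm s w ⊕ quadForm s′ w′ ≈ quadForm (s + s′) (w + w′)
  quadForm-+ s w s′ w′ = ≈-trans
    (solve 6 (λ s w s′ w′ x y → (((s ⊠ x) ⊞ (w ⊠ y)) ⊞ ((s′ ⊠ x) ⊞ (w′ ⊠ y))) ⊜ (((s ⊞ s′) ⊠ x) ⊞ ((w ⊞ w′) ⊠ y)))
       ≈-refl (κ s) (κ w) (κ s′) (κ w′) X Y)
    (⊕-cong (⊗-cong (≈-sym (κ-+ s s′)) (≈-refl {X})) (⊗-cong (≈-sym (κ-+ w w′)) (≈-refl {Y})))

  quadForm-split : ∀ s w m t u → quadForm (s + m * t) (w + m * u) ≈ quadForm s w ⊕ (κ m ⊗ quadForm t u)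
  quadForm-split s w m t u = begin
    quadForm (s + m * t) (w + m * u)                         ≈⟨ ≈-sym (quadForm-+ s w (m * t) (m * u)) ⟩
    quadForm s w ⊕ quadForm (m * t) (m * u)
      ≈⟨ ⊕-cong (≈-refl {quadForm s w}) (⊕-cong (⊗-cong (κ-* m t) (≈-refl {X})) (⊗-cong (κ-* m u) (≈-refl {Y}))) ⟩
    quadForm s w ⊕ (((κ m ⊗ κ t) ⊗ X) ⊕ ((κ m ⊗ κ u) ⊗ Y))
      ≈⟨ ⊕-cong (≈-refl {quadForm s w})
                (solve 5 (λ m t u x y → (((m ⊠ t) ⊠ x) ⊞ ((m ⊠ u) ⊠ y)) ⊜ (m ⊠ ((t ⊠ x) ⊞ (u ⊠ y)))) ≈-refl (κ m) (κ t) (κ u) X Y) ⟩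
    quadForm s w ⊕ (κ m ⊗ quadForm t u)                      ∎
    where open SetoidReasoning polySetoid

  pairedFactor-odd≈X : ∀ {K} c → K ≡ c + c + 1ℤ → ∀ β → pairedFactor K β ≈ X ⟨mod + 2 ⟩
  pairedFactor-odd≈X {K} c refl β = begin
    pairedFactor K β                  ≈⟨ ≈⇒≈mod (pairedFactor-≈ K β) ⟩
    quadForm (K * K) (β * (K - β))    ≈⟨ quadForm-≈mod K²-odd β[K-β]-even ⟩
    quadForm 1ℤ 0ℤ                    ≈⟨ ≈⇒≈mod quadForm-1-0 ⟩
    X                                 ∎
    where
    open SetoidReasoning (≈mod-setoid (+ 2))
    K²-odd : K * K ≡ 1ℤ ⟨mod + 2 ⟩
    K²-odd = ≡mod-by (c * c + c * c + c + c) (identity c)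
      where identity : ∀ c → (c + c + 1ℤ) * (c + c + 1ℤ) - 1ℤ ≡ (c * c + c * c + c + c) * + 2
            identity = solve-∀
    β[K-β]-even : β * (K - β) ≡ 0ℤ ⟨mod + 2 ⟩
    β[K-β]-even = ∣⇒≡mod (subst (+ 2 ∣_) (identity c β) (∣m∣n⇒∣m-n (divides (c * β) refl) (2∣t[t+1] (β - 1ℤ))))
      where identity : ∀ c β → (c * β) * + 2 - (β - 1ℤ) * ((β - 1ℤ) + 1ℤ) ≡ β * (c + c + 1ℤ - β) - 0ℤ
            identity = solve-∀

  -- Both factors on the left are Q + 2μ A for Q = pairedFactor K′ γ; the cross term 2μ (A + A′) Q is
  -- 2μ x(1 - x)² modulo 4μ because A + A′ ≡ (1 - x)² and Q ≡ x modulo 2.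
  pairedFactor-shift : ∀ {K K′} c μ → K′ ≡ c + c + 1ℤ → K ≡ K′ + + 2 * μ → ∀ γ →
    pairedFactor K γ ⊗ pairedFactor K (K′ - γ) ≈ (pairedFactor K′ γ ⊗ pairedFactor K′ γ) ⊕ (κ (+ 2 * μ) ⊗ (X ⊗ Y)) ⟨mod + 2 * (+ 2 * μ) ⟩
  pairedFactor-shift c μ refl refl γ = begin
    pairedFactor (K′ + m) γ ⊗ pairedFactor (K′ + m) (K′ - γ)
      ≈⟨ ≈⇒≈mod (⊗-cong (split γ (expand-γ K′ m γ)) (split (K′ - γ) (expand-K′-γ K′ m γ))) ⟩
    (Q ⊕ (κ m ⊗ A)) ⊗ (Q ⊕ (κ m ⊗ A′))
      ≈⟨ ≈⇒≈mod (solve 4 (λ q m a a′ → ((q ⊞ (m ⊠ a)) ⊠ (q ⊞ (m ⊠ a′)))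
                                         ⊜ ((q ⊠ q) ⊞ ((m ⊠ ((a ⊞ a′) ⊠ q)) ⊞ (m ⊠ (m ⊠ (a ⊠ a′))))))
                           ≈-refl Q (κ m) A A′) ⟩
    (Q ⊗ Q) ⊕ ((κ m ⊗ ((A ⊕ A′) ⊗ Q)) ⊕ (κ m ⊗ (κ m ⊗ (A ⊗ A′))))
      ≈⟨ ≈mod-⊕ (≈mod-refl {Q ⊗ Q}) (≈mod-⊕ first-order second-order) ⟩
    (Q ⊗ Q) ⊕ ((κ m ⊗ (X ⊗ Y)) ⊕ [])
      ≈⟨ ≈⇒≈mod (⊕-cong (⊗-cong Q≈ Q≈) (⊕-identityʳ (κ m ⊗ (X ⊗ Y)))) ⟩
    (pairedFactor K′ γ ⊗ pairedFactor K′ γ) ⊕ (κ m ⊗ (X ⊗ Y)) ∎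
    where
    open SetoidReasoning (≈mod-setoid (+ 2 * (+ 2 * μ)))
    K′ = c + c + 1ℤ
    m = + 2 * μ
    t = K′ + K′ + m
    Q = quadForm (K′ * K′) (γ * (K′ - γ))
    A = quadForm t γ
    A′ = quadForm t (K′ - γ)
    expand-γ : ∀ K′ m γ → γ * (K′ + m - γ) ≡ γ * (K′ - γ) + m * γ
    expand-γ = solve-∀
    expand-K′-γ : ∀ K′ m γ → (K′ - γ) * (K′ + m - (K′ - γ)) ≡ γ * (K′ - γ) + m * (K′ - γ)
    expand-K′-γ = solve-∀
    expand-K² : ∀ K′ m → (K′ + m) * (K′ + m) ≡ K′ * K′ + m * (K′ + K′ + m)
    expand-K² = solve-∀
    split : ∀ β → β * (K′ + m - β) ≡ γ * (K′ - γ) + m * β → pairedFactor (K′ + m) β ≈ Q ⊕ (κ m ⊗ quadForm t β)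
    split β w≡ = ≈-trans (pairedFactor-≈ (K′ + m) β)
                 (≈-trans (≈-reflexive (cong₂ quadForm (expand-K² K′ m) w≡)) (quadForm-split (K′ * K′) (γ * (K′ - γ)) m t β))
    Q≈ : Q ≈ pairedFactor K′ γ
    Q≈ = ≈-sym (pairedFactor-≈ K′ γ)
    Q≈X : Q ≈ X ⟨mod + 2 ⟩
    Q≈X = ≈mod-trans (≈⇒≈mod Q≈) (pairedFactor-odd≈X c refl γ)
    A+A′≈Y : A ⊕ A′ ≈ Y ⟨mod + 2 ⟩
    A+A′≈Y = ≈mod-trans (≈⇒≈mod (quadForm-+ t γ t (K′ - γ))) (≈mod-trans parity (≈⇒≈mod quadForm-0-1))
      where parity : quadForm (t + t) (γ + (K′ - γ)) ≈ quadForm 0ℤ 1ℤ ⟨mod + 2 ⟩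
            parity = quadForm-≈mod 2t-even K′-odd
              where 2t-even : t + t ≡ 0ℤ ⟨mod + 2 ⟩
                    2t-even = ≡mod-by t (identity t)
                      where identity : ∀ t → t + t - 0ℤ ≡ t * + 2
                            identity = solve-∀
                    K′-odd : γ + (K′ - γ) ≡ 1ℤ ⟨mod + 2 ⟩
                    K′-odd = ≡mod-by c (identity c γ)
                      where identity : ∀ c γ → γ + (c + c + 1ℤ - γ) - 1ℤ ≡ c * + 2
                            identity = solve-∀
    first-order : κ m ⊗ ((A ⊕ A′) ⊗ Q) ≈ κ m ⊗ (X ⊗ Y) ⟨mod + 2 * m ⟩
    first-order = ≈mod-modulus (ℤₚ.*-comm m (+ 2))
      (≈mod-κ⊗ m (≈mod-trans (≈mod-⊗ A+A′≈Y Q≈X) (≈⇒≈mod (⊗-comm Y X))))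
    second-order : κ m ⊗ (κ m ⊗ (A ⊗ A′)) ≈ [] ⟨mod + 2 * m ⟩
    second-order = square≈mod[] μ (A ⊗ A′)

  factorℤ-shift : ∀ K m β → factorℤ (K + m) β ≈ factorℤ K β ⟨mod m ⟩
  factorℤ-shift K m β = linear-≈mod (≡mod-by 1ℤ (identity K m β)) (≡⇒≡mod refl)
    where identity : ∀ K m β → K + m - β - (K - β) ≡ 1ℤ * m
          identity = solve-∀

  factorℤ-shift₂ : ∀ K m β → factorℤ (K + m) (β + m) ≈ factorℤ K β ⟨mod m ⟩
  factorℤ-shift₂ K m β = linear-≈mod (≡⇒≡mod (identity K m β)) (≡mod-by 1ℤ (identity′ m β))
    where identity : ∀ K m β → K + m - (β + m) ≡ K - β
          identity = solve-∀
          identity′ : ∀ m β → β + m - β ≡ 1ℤ * m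
          identity′ = solve-∀

  -- For n = j + 1 the factors of prodPoly n are (K - i) + i x, 0 ≤ i < 2j, with K = 2j - 1;
  -- in this range the truncated subtractions in `factor` are exact.
  prodPoly-window : ∀ j → prodPoly (suc j) ≈ window (factorℤ (+ j + + j - 1ℤ)) 0ℤ (j ℕ.+ j)
  prodPoly-window j = subst (λ N → foldr (λ i acc → factor (N ℕ.∸ 3) i ⊗ acc) one (upTo (N ℕ.∸ 2)) ≈ W)
                            (sym (2[1+j]≡2+[j+j] j))
                            (window-foldr (factor (j ℕ.+ j ℕ.∸ 1)) (factorℤ K) id 0ℤ (j ℕ.+ j) factor≈)
    where
    K = + j + + j - 1ℤ
    W = window (factorℤ K) 0ℤ (j ℕ.+ j)
    2[1+j]≡2+[j+j] : ∀ j → 2 ℕ.* suc j ≡ 2 ℕ.+ (j ℕ.+ j)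
    2[1+j]≡2+[j+j] = ℕ-solve-∀
    factor≈ : ∀ i → i ℕ.< j ℕ.+ j → factor (j ℕ.+ j ℕ.∸ 1) i ≈ factorℤ K (0ℤ + + i)
    factor≈ i i<2j = ≈-reflexive (cong (λ a → linear a (+ i)) (begin
      + (j ℕ.+ j ℕ.∸ 1 ℕ.∸ i)       ≡⟨ pos-∸ (subst (i ℕ.≤_) (ℕₚ.pred[m∸n]≡m∸[1+n] (j ℕ.+ j) 0) (ℕₚ.<⇒≤pred i<2j)) ⟩
      + (j ℕ.+ j ℕ.∸ 1) - + i       ≡⟨ cong (_- + i) (pos-∸ (ℕₚ.≤-trans (s≤s z≤n) i<2j)) ⟩
      + (j ℕ.+ j) - 1ℤ - + i        ≡⟨ cong (λ a → a - 1ℤ - + i) (ℤₚ.pos-+ j j) ⟩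
      K - + i                       ∎))
      where open ≡-Reasoning

  prodPoly-mod2 : ∀ j → prodPoly (suc j) ≈ monomial j ⟨mod + 2 ⟩
  prodPoly-mod2 j = begin
    prodPoly (suc j)                         ≈⟨ ≈⇒≈mod (prodPoly-window j) ⟩
    window (factorℤ K) 0ℤ (j ℕ.+ j)          ≈⟨ ≈⇒≈mod (window-fold (factorℤ K) K 0ℤ j (cong (_- 1ℤ) (ℤₚ.pos-+ j j))) ⟩
    window (pairedFactor K) 0ℤ j             ≈⟨ window-≈mod (pairedFactor-odd≈X (+ j - 1ℤ) (odd (+ j))) 0ℤ j ⟩
    window (λ _ → X) 0ℤ j                    ≈⟨ ≈⇒≈mod (window-X 0ℤ j) ⟩
    monomial j                               ∎
    where
    open SetoidReasoning (≈mod-setoid (+ 2))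
    K = + j + + j - 1ℤ
    odd : ∀ x → x + x - 1ℤ ≡ (x - 1ℤ) + (x - 1ℤ) + 1ℤ
    odd = solve-∀

  -- Symmetric blocks

  symmetricBlock : ℕ → ℤ → Poly
  symmetricBlock N b = window (factorℤ (b + b + + N - 1ℤ)) b N

  symmetricBlock-fold : ∀ ℓ b → symmetricBlock (2 ℕ.* ℓ) b ≈ window (pairedFactor (b + b + + (2 ℕ.* ℓ) - 1ℤ)) b ℓ
  symmetricBlock-fold ℓ b = ≈-trans (≈-reflexive (cong (window (factorℤ K) b) (2*≡+ ℓ)))
                                    (window-fold (factorℤ K) K b ℓ (cong (λ n → b + b + + n - 1ℤ) (2*≡+ ℓ)))
    where K = b + b + + (2 ℕ.* ℓ) - 1ℤ

  -- Folding twice pairs the factors at γ, K - γ, K′ - γ and K - (K′ - γ), where K′ is the centre of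
  -- the half block; against the square of the half block the perturbations cancel in pairs, which
  -- needs an even number 2L of such quadruples.
  symmetricBlock-double : ∀ L b → symmetricBlock (2 ℕ.* (2 ℕ.* (2 ℕ.* L))) b ≈
    symmetricBlock (2 ℕ.* (2 ℕ.* L)) b ⊗ symmetricBlock (2 ℕ.* (2 ℕ.* L)) b ⟨mod + (2 ℕ.* (2 ℕ.* (2 ℕ.* L))) ⟩
  symmetricBlock-double L b = ≈mod-modulus (sym (pos-2*2* ℓ)) (begin
    symmetricBlock (2 ℕ.* m) b                             ≈⟨ ≈⇒≈mod (symmetricBlock-fold m b) ⟩
    window (pairedFactor K) b (2 ℕ.* ℓ)                    ≈⟨ ≈⇒≈mod (≈-reflexive (cong (window (pairedFactor K) b) (2*≡+ ℓ))) ⟩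
    window (pairedFactor K) b (ℓ ℕ.+ ℓ)                    ≈⟨ ≈⇒≈mod (window-fold (pairedFactor K) K′ b ℓ (cong (λ n → b + b + + n - 1ℤ) (2*≡+ ℓ))) ⟩
    window g b ℓ                                           ≈⟨ ≈⇒≈mod (≈-reflexive (cong (window g b) (2*≡+ L))) ⟩
    window g b (L ℕ.+ L)                                   ≈⟨ window-≈mod-perturbed (+ ℓ) (X ⊗ Y) (X ⊗ X) g≈ h≈ b L ⟩
    window h b (L ℕ.+ L)                                   ≈⟨ ≈⇒≈mod (≈-reflexive (cong (window h b) (sym (2*≡+ L)))) ⟩
    window h b ℓ                                           ≈⟨ ≈⇒≈mod (window-⊗ (pairedFactor K′) (pairedFactor K′) b ℓ) ⟩
    window (pairedFactor K′) b ℓ ⊗ window (pairedFactor K′) b ℓ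
                                                           ≈⟨ ≈⇒≈mod (≈-sym (⊗-cong (symmetricBlock-fold ℓ b) (symmetricBlock-fold ℓ b))) ⟩
    symmetricBlock m b ⊗ symmetricBlock m b                ∎)
    where
    ℓ = 2 ℕ.* L
    m = 2 ℕ.* ℓ
    open SetoidReasoning (≈mod-setoid (+ 2 * (+ 2 * + ℓ)))
    K = b + b + + (2 ℕ.* m) - 1ℤ
    K′ = b + b + + m - 1ℤ
    g : ℤ → Poly
    g γ = pairedFactor K γ ⊗ pairedFactor K (K′ - γ)
    h : ℤ → Poly
    h γ = pairedFactor K′ γ ⊗ pairedFactor K′ γ
    c = b + + ℓ - 1ℤ
    +m≡ : + m ≡ + 2 * + ℓ
    +m≡ = ℤₚ.pos-* 2 ℓ
    K′≡ : K′ ≡ c + c + 1ℤ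
    K′≡ = trans (cong (λ n → b + b + n - 1ℤ) +m≡) (identity b (+ ℓ))
      where identity : ∀ b x → b + b + + 2 * x - 1ℤ ≡ (b + x - 1ℤ) + (b + x - 1ℤ) + 1ℤ
            identity = solve-∀
    K≡ : K ≡ K′ + + 2 * + ℓ
    K≡ = trans (cong (λ n → b + b + n - 1ℤ) (pos-2*2* ℓ))
         (trans (identity b (+ ℓ)) (cong (λ n → b + b + n - 1ℤ + + 2 * + ℓ) (sym +m≡)))
      where identity : ∀ b x → b + b + + 2 * (+ 2 * x) - 1ℤ ≡ b + b + + 2 * x - 1ℤ + + 2 * x
            identity = solve-∀
    g≈ : ∀ γ → g γ ≈ h γ ⊕ (κ (+ 2 * + ℓ) ⊗ (X ⊗ Y)) ⟨mod + 2 * (+ 2 * + ℓ) ⟩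
    g≈ = pairedFactor-shift c (+ ℓ) K′≡ K≡
    h≈ : ∀ γ → h γ ≈ X ⊗ X ⟨mod + 2 ⟩
    h≈ γ = ≈mod-⊗ (pairedFactor-odd≈X c K′≡ γ) (pairedFactor-odd≈X c K′≡ γ)

  nextD : ℕ → Poly → Poly
  nextD μ D = (monomial (2 ℕ.* μ) ⊗ D) ⊕ (κ (+ μ) ⊗ (D ⊗ D))

  square-decomposition : ∀ μ D → let M = 2 ℕ.* μ in
    (monomial M ⊕ (κ (+ M) ⊗ D)) ⊗ (monomial M ⊕ (κ (+ M) ⊗ D)) ≈ monomial (2 ℕ.* M) ⊕ (κ (+ (2 ℕ.* M)) ⊗ nextD μ D)
  square-decomposition μ D = begin
    (xᴹ ⊕ (κ (+ M) ⊗ D)) ⊗ (xᴹ ⊕ (κ (+ M) ⊗ D))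
      ≈⟨ ⊗-cong M-split M-split ⟩
    (xᴹ ⊕ ((two ⊗ κ (+ μ)) ⊗ D)) ⊗ (xᴹ ⊕ ((two ⊗ κ (+ μ)) ⊗ D))
      ≈⟨ solve 3 (λ x u d → ((x ⊞ ((Κ two ⊠ u) ⊠ d)) ⊠ (x ⊞ ((Κ two ⊠ u) ⊠ d)))
                            ⊜ ((x ⊠ x) ⊞ ((Κ two ⊠ (Κ two ⊠ u)) ⊠ ((x ⊠ d) ⊞ (u ⊠ (d ⊠ d)))))) ≈-refl xᴹ (κ (+ μ)) D ⟩
    (xᴹ ⊗ xᴹ) ⊕ ((two ⊗ (two ⊗ κ (+ μ))) ⊗ nextD μ D)
      ≈⟨ ⊕-cong (≈-sym (≈-trans (≈-reflexive (cong monomial (2*≡+ M))) (monomial-+ M M)))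
                (⊗-cong (≈-sym (κ-2*2* (+ μ))) (≈-refl {nextD μ D})) ⟩
    monomial (2 ℕ.* M) ⊕ (κ (+ 2 * (+ 2 * + μ)) ⊗ nextD μ D)
      ≡⟨ cong (λ n → monomial (2 ℕ.* M) ⊕ (κ n ⊗ nextD μ D)) (sym (pos-2*2* μ)) ⟩
    monomial (2 ℕ.* M) ⊕ (κ (+ (2 ℕ.* M)) ⊗ nextD μ D) ∎
    where
    open SetoidReasoning polySetoid
    M = 2 ℕ.* μ
    xᴹ = monomial M
    two = κ (+ 2)
    +M≡ : + M ≡ + 2 * + μ
    +M≡ = ℤₚ.pos-* 2 μ
    M-split : xᴹ ⊕ (κ (+ M) ⊗ D) ≈ xᴹ ⊕ ((two ⊗ κ (+ μ)) ⊗ D)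
    M-split = ⊕-cong (≈-refl {xᴹ}) (⊗-cong (≈-trans (≈-reflexive (cong κ +M≡)) (κ-* (+ 2) (+ μ))) (≈-refl {D}))

  nextD-odd : ∀ ν D → coeff (oneMinusX ⊗ D) (2 ℕ.* (2 ℕ.* ν)) ≡ 1ℤ ⟨mod + 2 ⟩ →
              coeff (oneMinusX ⊗ nextD (2 ℕ.* ν) D) (2 ℕ.* (2 ℕ.* (2 ℕ.* ν))) ≡ 1ℤ ⟨mod + 2 ⟩
  nextD-odd ν D odd = ≡mod-trans (≡⇒≡mod coeff≡) (≡mod-+ odd even)
    where
    μ = 2 ℕ.* ν
    M = 2 ℕ.* μ
    Δ = coeff (oneMinusX ⊗ (D ⊗ D)) (2 ℕ.* M)
    split : oneMinusX ⊗ nextD μ D ≈ (monomial M ⊗ (oneMinusX ⊗ D)) ⊕ (κ (+ μ) ⊗ (oneMinusX ⊗ (D ⊗ D)))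
    split = solve 4 (λ o x d u → (o ⊠ ((x ⊠ d) ⊞ (u ⊠ (d ⊠ d)))) ⊜ ((x ⊠ (o ⊠ d)) ⊞ (u ⊠ (o ⊠ (d ⊠ d))))) ≈-refl oneMinusX (monomial M) D (κ (+ μ))
    coeff≡ : coeff (oneMinusX ⊗ nextD μ D) (2 ℕ.* M) ≡ coeff (oneMinusX ⊗ D) M + + μ * Δ
    coeff≡ = begin
      coeff (oneMinusX ⊗ nextD μ D) (2 ℕ.* M)                                    ≡⟨ coeff-≡ split (2 ℕ.* M) ⟩
      coeff ((monomial M ⊗ (oneMinusX ⊗ D)) ⊕ (κ (+ μ) ⊗ (oneMinusX ⊗ (D ⊗ D)))) (2 ℕ.* M)
                                                                                 ≡⟨ coeff-⊕ (monomial M ⊗ (oneMinusX ⊗ D)) _ (2 ℕ.* M) ⟩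
      coeff (monomial M ⊗ (oneMinusX ⊗ D)) (2 ℕ.* M) + coeff (κ (+ μ) ⊗ (oneMinusX ⊗ (D ⊗ D))) (2 ℕ.* M)
        ≡⟨ cong₂ _+_ (trans (cong (coeff (monomial M ⊗ (oneMinusX ⊗ D))) (2*≡+ M)) (coeff-monomial⊗ M (oneMinusX ⊗ D) M))
                     (coeff-κ⊗ (+ μ) (oneMinusX ⊗ (D ⊗ D)) (2 ℕ.* M)) ⟩
      coeff (oneMinusX ⊗ D) M + + μ * Δ                                          ∎
      where open ≡-Reasoning
    even : + μ * Δ ≡ 0ℤ ⟨mod + 2 ⟩
    even = ≡mod-by (+ ν * Δ) (trans (ℤₚ.+-identityʳ _) (trans (cong (_* Δ) (ℤₚ.pos-* 2 ν)) (identity (+ ν) Δ)))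
      where identity : ∀ ν Δ → + 2 * ν * Δ ≡ ν * Δ * + 2
            identity = solve-∀

  record BlockDecomposition (r : ℕ) (b : ℤ) : Set where
    field
      D      : Poly
      block≈ : symmetricBlock (2 ^ suc (suc r)) b ≈ monomial (2 ^ suc r) ⊕ (κ (+ (2 ^ suc r)) ⊗ D) ⟨mod + (2 ^ suc (suc r)) ⟩
      odd    : coeff (oneMinusX ⊗ D) (2 ^ suc r) ≡ 1ℤ ⟨mod + 2 ⟩

  blockDecomposition-base : ∀ b → BlockDecomposition 0 b
  blockDecomposition-base b = record { D = X ⊗ Y ; block≈ = block≈ ; odd = ≡mod-by -[1+ 1 ] refl }
    where
    K = b + b + + 4 - 1ℤ
    K′ = b + b + 1ℤ
    open SetoidReasoning (≈mod-setoid (+ 4))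
    block≈ : symmetricBlock 4 b ≈ monomial 2 ⊕ (κ (+ 2) ⊗ (X ⊗ Y)) ⟨mod + 4 ⟩
    block≈ = begin
      symmetricBlock 4 b                                           ≈⟨ ≈⇒≈mod (symmetricBlock-fold 2 b) ⟩
      window (pairedFactor K) b 2                                  ≈⟨ ≈⇒≈mod (window-fold (pairedFactor K) K′ b 1 (identity b)) ⟩
      (pairedFactor K b ⊗ pairedFactor K (K′ - b)) ⊗ one           ≈⟨ ≈⇒≈mod (⊗-identityʳ _) ⟩
      pairedFactor K b ⊗ pairedFactor K (K′ - b)                   ≈⟨ pairedFactor-shift b 1ℤ refl (identity′ b) b ⟩
      (pairedFactor K′ b ⊗ pairedFactor K′ b) ⊕ (κ (+ 2) ⊗ (X ⊗ Y))
        ≈⟨ ≈mod-⊕ (≈mod-square 1ℤ (pairedFactor-odd≈X b refl b)) (≈mod-refl {κ (+ 2) ⊗ (X ⊗ Y)}) ⟩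
      (X ⊗ X) ⊕ (κ (+ 2) ⊗ (X ⊗ Y))
        ≈⟨ ≈⇒≈mod (⊕-cong (⊗-cong (≈-refl {X}) (≈-sym (⊗-identityʳ X))) (≈-refl {κ (+ 2) ⊗ (X ⊗ Y)})) ⟩
      monomial 2 ⊕ (κ (+ 2) ⊗ (X ⊗ Y))                             ∎
      where identity : ∀ b → b + b + 1ℤ ≡ b + b + + 2 - 1ℤ
            identity = solve-∀
            identity′ : ∀ b → b + b + + 4 - 1ℤ ≡ b + b + 1ℤ + + 2 * 1ℤ
            identity′ = solve-∀

  blockDecomposition-step : ∀ {r b} (bd : BlockDecomposition r b) →
    coeff (oneMinusX ⊗ nextD (2 ^ r) (BlockDecomposition.D bd)) (2 ^ suc (suc r)) ≡ 1ℤ ⟨mod + 2 ⟩ →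
    BlockDecomposition (suc r) b
  blockDecomposition-step {r} {b} bd odd′ = record { D = nextD (2 ^ r) D ; block≈ = block≈′ ; odd = odd′ }
    where
    open BlockDecomposition bd
    M = 2 ^ suc r
    Z = monomial M ⊕ (κ (+ M) ⊗ D)
    open SetoidReasoning (≈mod-setoid (+ (2 ℕ.* (2 ℕ.* M))))
    block≈′ : symmetricBlock (2 ℕ.* (2 ℕ.* M)) b ≈ monomial (2 ℕ.* M) ⊕ (κ (+ (2 ℕ.* M)) ⊗ nextD (2 ^ r) D) ⟨mod + (2 ℕ.* (2 ℕ.* M)) ⟩
    block≈′ = begin
      symmetricBlock (2 ℕ.* (2 ℕ.* M)) b                         ≈⟨ symmetricBlock-double (2 ^ r) b ⟩
      symmetricBlock (2 ℕ.* M) b ⊗ symmetricBlock (2 ℕ.* M) b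
        ≈⟨ ≈mod-modulus (sym (pos-2*2* M)) (≈mod-square (+ M) (≈mod-modulus (ℤₚ.pos-* 2 M) block≈)) ⟩
      Z ⊗ Z                                                      ≈⟨ ≈⇒≈mod (square-decomposition (2 ^ r) D) ⟩
      monomial (2 ℕ.* M) ⊕ (κ (+ (2 ℕ.* M)) ⊗ nextD (2 ^ r) D)   ∎

  blockDecomposition : ∀ r b → BlockDecomposition r b
  blockDecomposition zero          b = blockDecomposition-base b
  -- nextD-odd needs 2 ^ r even; for r = 1 the parity is computed.
  blockDecomposition (suc zero)    b = blockDecomposition-step (blockDecomposition-base b) (≡mod-by (+ 3) refl)
  blockDecomposition (suc (suc r)) b with blockDecomposition (suc r) b
  ... | bd = blockDecomposition-step bd (nextD-odd (2 ^ r) (BlockDecomposition.D bd) (BlockDecomposition.odd bd))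

  -- The case i ≥ 1

  -- The 2N extra factors of P_{N+j+1} sit in the middle and form a symmetric block; the outer
  -- factors agree with those of P_{j+1} modulo 2N.
  prodPoly-splice : ∀ N j → prodPoly (N ℕ.+ suc j) ≈ prodPoly (suc j) ⊗ symmetricBlock (2 ℕ.* N) (+ j) ⟨mod + (2 ℕ.* N) ⟩
  prodPoly-splice N j = begin
    prodPoly (N ℕ.+ suc j)
      ≡⟨ cong prodPoly (ℕₚ.+-suc N j) ⟩
    prodPoly (suc (N ℕ.+ j))
      ≈⟨ ≈⇒≈mod (≈-trans (prodPoly-window (N ℕ.+ j)) (≈-reflexive (cong₂ (λ k n → window (factorℤ k) 0ℤ n) K′≡ length≡))) ⟩
    window g′ 0ℤ (j ℕ.+ (2N ℕ.+ j))
      ≈⟨ ≈⇒≈mod (≈-trans (window-+ g′ 0ℤ j (2N ℕ.+ j)) (⊗-cong (≈-refl {window g′ 0ℤ j}) (window-+ g′ (+ j) 2N j))) ⟩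
    window g′ 0ℤ j ⊗ (window g′ (+ j) 2N ⊗ window g′ (+ j + + 2N) j)
      ≈⟨ ≈mod-⊗ (window-≈mod (factorℤ-shift K (+ 2N)) 0ℤ j) (≈mod-⊗ (≈⇒≈mod middle≈) outer≈) ⟩
    window g 0ℤ j ⊗ (symmetricBlock 2N (+ j) ⊗ window g (+ j) j)
      ≈⟨ ≈⇒≈mod (solve 3 (λ a s b → (a ⊠ (s ⊠ b)) ⊜ ((a ⊠ b) ⊠ s)) ≈-refl (window g 0ℤ j) (symmetricBlock 2N (+ j)) (window g (+ j) j)) ⟩
    (window g 0ℤ j ⊗ window g (+ j) j) ⊗ symmetricBlock 2N (+ j)
      ≈⟨ ≈⇒≈mod (⊗-cong (≈-sym (≈-trans (prodPoly-window j) (window-+ g 0ℤ j j))) (≈-refl {symmetricBlock 2N (+ j)})) ⟩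
    prodPoly (suc j) ⊗ symmetricBlock 2N (+ j) ∎
    where
    2N = 2 ℕ.* N
    open SetoidReasoning (≈mod-setoid (+ 2N))
    K = + j + + j - 1ℤ
    g = factorℤ K
    g′ = factorℤ (K + + 2N)
    K′≡ : + (N ℕ.+ j) + + (N ℕ.+ j) - 1ℤ ≡ K + + 2N
    K′≡ = trans (cong₂ (λ a b → a + b - 1ℤ) (ℤₚ.pos-+ N j) (ℤₚ.pos-+ N j))
          (trans (identity (+ N) (+ j)) (cong (λ n → K + n) (sym (ℤₚ.pos-* 2 N))))
      where identity : ∀ n j → n + j + (n + j) - 1ℤ ≡ j + j - 1ℤ + + 2 * n
            identity = solve-∀
    length≡ : (N ℕ.+ j) ℕ.+ (N ℕ.+ j) ≡ j ℕ.+ (2 ℕ.* N ℕ.+ j)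
    length≡ = identity N j
      where identity : ∀ N j → (N ℕ.+ j) ℕ.+ (N ℕ.+ j) ≡ j ℕ.+ (2 ℕ.* N ℕ.+ j)
            identity = ℕ-solve-∀
    middle≈ : window g′ (+ j) 2N ≈ symmetricBlock 2N (+ j)
    middle≈ = ≈-reflexive (cong (λ k → window (factorℤ k) (+ j) 2N) (identity (+ j) (+ 2N)))
      where identity : ∀ j n → j + j - 1ℤ + n ≡ j + j + n - 1ℤ
            identity = solve-∀
    outer≈ : window g′ (+ j + + 2N) j ≈ window g (+ j) j ⟨mod + 2N ⟩
    outer≈ = ≈mod-trans (≈⇒≈mod (window-shift g′ (+ 2N) (+ j) j)) (window-≈mod (factorℤ-shift₂ K (+ 2N)) (+ j) j)

  prodPoly-shift : ∀ N j D → symmetricBlock (2 ℕ.* N) (+ j) ≈ monomial N ⊕ (κ (+ N) ⊗ D) ⟨mod + (2 ℕ.* N) ⟩ →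
    prodPoly (N ℕ.+ suc j) ≈ (monomial N ⊗ prodPoly (suc j)) ⊕ (κ (+ N) ⊗ (monomial j ⊗ D)) ⟨mod + (2 ℕ.* N) ⟩
  prodPoly-shift N j D block≈ = begin
    prodPoly (N ℕ.+ suc j)                        ≈⟨ prodPoly-splice N j ⟩
    P ⊗ symmetricBlock (2 ℕ.* N) (+ j)             ≈⟨ ≈mod-⊗ (≈mod-refl {P}) block≈ ⟩
    P ⊗ (monomial N ⊕ (κ (+ N) ⊗ D))
      ≈⟨ ≈⇒≈mod (solve 4 (λ p x n d → (p ⊠ (x ⊞ (n ⊠ d))) ⊜ ((x ⊠ p) ⊞ (n ⊠ (p ⊠ d)))) ≈-refl P (monomial N) (κ (+ N)) D) ⟩
    (monomial N ⊗ P) ⊕ (κ (+ N) ⊗ (P ⊗ D))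
      ≈⟨ ≈mod-⊕ (≈mod-refl {monomial N ⊗ P}) (≈mod-modulus 2N≡ (≈mod-κ⊗ (+ N) (≈mod-⊗ (prodPoly-mod2 j) (≈mod-refl {D})))) ⟩
    (monomial N ⊗ P) ⊕ (κ (+ N) ⊗ (monomial j ⊗ D)) ∎
    where
    open SetoidReasoning (≈mod-setoid (+ (2 ℕ.* N)))
    P = prodPoly (suc j)
    2N≡ : + N * + 2 ≡ + (2 ℕ.* N)
    2N≡ = trans (ℤₚ.*-comm (+ N) (+ 2)) (sym (ℤₚ.pos-* 2 N))

  v-shift-suc : ∀ r j → v (2 ^ suc r ℕ.+ suc j) ≡ v (suc j) + + (2 ^ suc r) ⟨mod + (2 ^ suc (suc r)) ⟩
  v-shift-suc r j = begin
    v (M ℕ.+ suc j)                                         ≡⟨ cong v (ℕₚ.+-suc M j) ⟩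
    coeff (oneMinusX ⊗ prodPoly (suc (M ℕ.+ j))) (M ℕ.+ j)    ≡⟨ cong (λ n → coeff (oneMinusX ⊗ prodPoly n) (M ℕ.+ j)) (sym (ℕₚ.+-suc M j)) ⟩
    coeff (oneMinusX ⊗ prodPoly (M ℕ.+ suc j)) (M ℕ.+ j)      ≈⟨ ≈mod⇒coeff (≈mod-⊗ (≈mod-refl {oneMinusX}) prodPoly≈) (M ℕ.+ j) ⟩
    coeff (oneMinusX ⊗ R) (M ℕ.+ j)                         ≡⟨ coeff-≡ split (M ℕ.+ j) ⟩
    coeff ((monomial M ⊗ W) ⊕ (κ (+ M) ⊗ (monomial j ⊗ E))) (M ℕ.+ j)
      ≡⟨ coeff-⊕ (monomial M ⊗ W) (κ (+ M) ⊗ (monomial j ⊗ E)) (M ℕ.+ j) ⟩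
    coeff (monomial M ⊗ W) (M ℕ.+ j) + coeff (κ (+ M) ⊗ (monomial j ⊗ E)) (M ℕ.+ j)
      ≡⟨ cong₂ _+_ (coeff-monomial⊗ M W j) (trans (coeff-κ⊗ (+ M) (monomial j ⊗ E) (M ℕ.+ j))
                   (cong (+ M *_) (trans (cong (coeff (monomial j ⊗ E)) (ℕₚ.+-comm M j)) (coeff-monomial⊗ j E M)))) ⟩
    v (suc j) + + M * coeff E M                              ≈⟨ ≡mod-+ (≡mod-refl (v (suc j))) (≡mod-odd-multiple M odd) ⟩
    v (suc j) + + M                                          ∎
    where
    M = 2 ^ suc r
    open BlockDecomposition (blockDecomposition r (+ j))
    open SetoidReasoning (≡mod-setoid (+ (2 ℕ.* M)))
    P = prodPoly (suc j)
    W = oneMinusX ⊗ P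
    E = oneMinusX ⊗ D
    R = (monomial M ⊗ P) ⊕ (κ (+ M) ⊗ (monomial j ⊗ D))
    prodPoly≈ : prodPoly (M ℕ.+ suc j) ≈ R ⟨mod + (2 ℕ.* M) ⟩
    prodPoly≈ = prodPoly-shift M j D block≈
    split : oneMinusX ⊗ R ≈ (monomial M ⊗ W) ⊕ (κ (+ M) ⊗ (monomial j ⊗ E))
    split = solve 6 (λ o x p m y d → (o ⊠ ((x ⊠ p) ⊞ (m ⊠ (y ⊠ d)))) ⊜ ((x ⊠ (o ⊠ p)) ⊞ (m ⊠ (y ⊠ (o ⊠ d))))) ≈-refl
              oneMinusX (monomial M) P (κ (+ M)) (monomial j) D

  -- The case i = 0

  -- Division by 2 + x, run downwards from the top where Y vanishes.
  coeff-div-2+x : ∀ m N {Y Z} → linear (+ 2) 1ℤ ⊗ Y ≈ Z ⟨mod + 2 * m ⟩ →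
    (∀ k → suc N ℕ.< k → coeff Z k ≡ 0ℤ ⟨mod m ⟩) → coeff Y N ≡ coeff Z (suc N) ⟨mod + 2 * m ⟩
  coeff-div-2+x m N {Y} {Z} Y≈Z Z≡0 = step N (vanish (length Y) (suc N) (ℕₚ.m≤n+m (length Y) (suc N)) ℕₚ.≤-refl)
    where
    step : ∀ i → coeff Y (suc i) ≡ 0ℤ ⟨mod m ⟩ → coeff Y i ≡ coeff Z (suc i) ⟨mod + 2 * m ⟩
    step i = ≡mod-cancel-double m (≡mod-trans (≡⇒≡mod rearrange) (≈mod⇒coeff Y≈Z (suc i)))
      where rearrange : coeff Y i + + 2 * coeff Y (suc i) ≡ coeff (linear (+ 2) 1ℤ ⊗ Y) (suc i)
            rearrange = trans (ℤₚ.+-comm (coeff Y i) (+ 2 * coeff Y (suc i)))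
                        (trans (cong (_+_ (+ 2 * coeff Y (suc i))) (sym (ℤₚ.*-identityˡ (coeff Y i))))
                               (sym (coeff-linear⊗ (+ 2) 1ℤ Y i)))
    vanish : ∀ d i → length Y ℕ.≤ i ℕ.+ d → suc N ℕ.≤ i → coeff Y i ≡ 0ℤ ⟨mod m ⟩
    vanish zero    i len≤ _    = ≡⇒≡mod (coeff-beyond-length Y i (subst (length Y ℕ.≤_) (ℕₚ.+-identityʳ i) len≤))
    vanish (suc d) i len≤ N<i = ≡mod-trans
      (≡mod-halve m (step i (vanish d (suc i) (subst (length Y ℕ.≤_) (ℕₚ.+-suc i d) len≤) (ℕₚ.m≤n⇒m≤1+n N<i))))
      (Z≡0 (suc i) (s≤s N<i))

  -- Division by 1 + 2x, run upwards from the constant term.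
  coeff-div-1+2x : ∀ m N {Y Z} → linear 1ℤ (+ 2) ⊗ Y ≈ Z ⟨mod + 2 * m ⟩ →
    (∀ k → k ℕ.< N → coeff Z k ≡ 0ℤ ⟨mod m ⟩) → coeff Y N ≡ coeff Z N ⟨mod + 2 * m ⟩
  coeff-div-1+2x m N {Y} {Z} Y≈Z Z≡0 = ascend N ℕₚ.≤-refl
    where
    base : coeff Y 0 ≡ coeff Z 0 ⟨mod + 2 * m ⟩
    base = ≡mod-trans (≡⇒≡mod (trans (sym (ℤₚ.*-identityˡ (coeff Y 0))) (sym (coeff-⊗ (linear 1ℤ (+ 2)) Y 0)))) (≈mod⇒coeff Y≈Z 0)
    step : ∀ i → coeff Y i ≡ 0ℤ ⟨mod m ⟩ → coeff Y (suc i) ≡ coeff Z (suc i) ⟨mod + 2 * m ⟩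
    step i = ≡mod-cancel-double m (≡mod-trans (≡⇒≡mod rearrange) (≈mod⇒coeff Y≈Z (suc i)))
      where rearrange : coeff Y (suc i) + + 2 * coeff Y i ≡ coeff (linear 1ℤ (+ 2) ⊗ Y) (suc i)
            rearrange = trans (cong (λ y → y + + 2 * coeff Y i) (sym (ℤₚ.*-identityˡ (coeff Y (suc i))))) (sym (coeff-linear⊗ 1ℤ (+ 2) Y i))
    vanish : ∀ k → k ℕ.< N → coeff Y k ≡ 0ℤ ⟨mod m ⟩
    vanish zero    0<N   = ≡mod-trans (≡mod-halve m base) (Z≡0 0 0<N)
    vanish (suc k) k+1<N = ≡mod-trans (≡mod-halve m (step k (vanish k (ℕₚ.<-trans (ℕₚ.n<1+n k) k+1<N)))) (Z≡0 (suc k) k+1<N)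
    ascend : ∀ k → k ℕ.≤ N → coeff Y k ≡ coeff Z k ⟨mod + 2 * m ⟩
    ascend zero    _   = base
    ascend (suc k) k<N = step k (vanish k k<N)

  -- The block of 2N factors centred like P_N, starting at β = -1, is P_N with one extra factor at
  -- each end, and these are -(2 + x) and -(1 + 2x) modulo 2N.
  symmetricBlock≈prodPoly : ∀ N₁ → let N = suc N₁ in
    symmetricBlock (2 ℕ.* N) -1ℤ ≈ linear (+ 2) 1ℤ ⊗ (linear 1ℤ (+ 2) ⊗ prodPoly N) ⟨mod + (2 ℕ.* N) ⟩
  symmetricBlock≈prodPoly N₁ = begin
    symmetricBlock (2 ℕ.* N) -1ℤ
      ≡⟨ cong₂ (λ k n → window (factorℤ k) -1ℤ n) K≡ length≡ ⟩
    window g -1ℤ (suc (L ℕ.+ 1))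
      ≈⟨ ≈⇒≈mod (⊗-cong (≈-refl {g -1ℤ}) (window-+ g 0ℤ L 1)) ⟩
    g -1ℤ ⊗ (window g 0ℤ L ⊗ (g (+ L) ⊗ one))
      ≈⟨ ≈mod-⊗ first (≈mod-⊗ (≈⇒≈mod (≈-sym (prodPoly-window N₁))) (≈mod-⊗ last (≈mod-refl {one}))) ⟩
    (⊖ linear (+ 2) 1ℤ) ⊗ (prodPoly N ⊗ ((⊖ linear 1ℤ (+ 2)) ⊗ one))
      ≈⟨ ≈⇒≈mod (solve 3 (λ a p b → ((⊟ a) ⊠ (p ⊠ ((⊟ b) ⊠ Κ one))) ⊜ (a ⊠ (b ⊠ p))) ≈-refl (linear (+ 2) 1ℤ) (prodPoly N) (linear 1ℤ (+ 2))) ⟩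
    linear (+ 2) 1ℤ ⊗ (linear 1ℤ (+ 2) ⊗ prodPoly N) ∎
    where
    N = suc N₁
    L = N₁ ℕ.+ N₁
    K = + N₁ + + N₁ - 1ℤ
    g = factorℤ K
    open SetoidReasoning (≈mod-setoid (+ (2 ℕ.* N)))
    +2N≡ : + (2 ℕ.* N) ≡ + 2 * (1ℤ + + N₁)
    +2N≡ = ℤₚ.pos-* 2 N
    K≡ : -1ℤ + -1ℤ + + (2 ℕ.* N) - 1ℤ ≡ K
    K≡ = trans (cong (λ x → -1ℤ + -1ℤ + x - 1ℤ) +2N≡) (identity (+ N₁))
      where identity : ∀ n → -1ℤ + -1ℤ + + 2 * (1ℤ + n) - 1ℤ ≡ n + n - 1ℤ
            identity = solve-∀
    length≡ : 2 ℕ.* N ≡ suc (L ℕ.+ 1)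
    length≡ = identity N₁
      where identity : ∀ n → 2 ℕ.* suc n ≡ suc ((n ℕ.+ n) ℕ.+ 1)
            identity = ℕ-solve-∀
    first : g -1ℤ ≈ ⊖ linear (+ 2) 1ℤ ⟨mod + (2 ℕ.* N) ⟩
    first = linear-≈mod (≡mod-by 1ℤ (trans (identity (+ N₁)) (cong (1ℤ *_) (sym +2N≡)))) (≡mod-refl -1ℤ)
      where identity : ∀ n → n + n - 1ℤ - -1ℤ - -[1+ 1 ] ≡ 1ℤ * (+ 2 * (1ℤ + n))
            identity = solve-∀
    last : g (+ L) ≈ ⊖ linear 1ℤ (+ 2) ⟨mod + (2 ℕ.* N) ⟩
    last = linear-≈mod (≡⇒≡mod (trans (cong (_-_ K) (ℤₚ.pos-+ N₁ N₁)) (identity (+ N₁))))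
                       (≡mod-by 1ℤ (trans (cong (_- -[1+ 1 ]) (ℤₚ.pos-+ N₁ N₁)) (trans (identity′ (+ N₁)) (cong (1ℤ *_) (sym +2N≡)))))
      where identity : ∀ n → n + n - 1ℤ - (n + n) ≡ -1ℤ
            identity = solve-∀
            identity′ : ∀ n → n + n - -[1+ 1 ] ≡ 1ℤ * (+ 2 * (1ℤ + n))
            identity′ = solve-∀

  v≡coeff-difference : ∀ n {Z} → let N = suc (suc n) in
    linear (+ 2) 1ℤ ⊗ (linear 1ℤ (+ 2) ⊗ prodPoly N) ≈ Z ⟨mod + (2 ℕ.* N) ⟩ →
    (∀ k → k ≢ N → coeff Z k ≡ 0ℤ ⟨mod + N ⟩) → v N ≡ coeff Z (suc n) - coeff Z N ⟨mod + (2 ℕ.* N) ⟩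
  v≡coeff-difference n {Z} ≈Z Z≡0 = begin
    v N                                                                   ≡⟨ coeff-linear⊗ 1ℤ -1ℤ P n ⟩
    1ℤ * coeff P (suc n) + -1ℤ * coeff P n                                ≡⟨ identity (coeff P (suc n)) (coeff P n) ⟩
    (+ 2 * coeff P (suc n) + 1ℤ * coeff P n) - (1ℤ * coeff P (suc n) + + 2 * coeff P n)
                                                                          ≡⟨ cong₂ _-_ (coeff-linear⊗ (+ 2) 1ℤ P n) (coeff-linear⊗ 1ℤ (+ 2) P n) ⟨
    coeff (linear (+ 2) 1ℤ ⊗ P) (suc n) - coeff (linear 1ℤ (+ 2) ⊗ P) (suc n)
                                                                          ≈⟨ ≡mod-+ low (≡mod-neg high) ⟩
    coeff Z (suc n) - coeff Z N                                           ∎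
    where
    N = suc (suc n)
    P = prodPoly N
    open SetoidReasoning (≡mod-setoid (+ (2 ℕ.* N)))
    identity : ∀ a b → 1ℤ * a + -1ℤ * b ≡ (+ 2 * a + 1ℤ * b) - (1ℤ * a + + 2 * b)
    identity = solve-∀
    ≈Z′ : linear (+ 2) 1ℤ ⊗ (linear 1ℤ (+ 2) ⊗ P) ≈ Z ⟨mod + 2 * + N ⟩
    ≈Z′ = ≈mod-modulus (ℤₚ.pos-* 2 N) ≈Z
    high : coeff (linear 1ℤ (+ 2) ⊗ P) (suc n) ≡ coeff Z N ⟨mod + (2 ℕ.* N) ⟩
    high = ≡mod-modulus (sym (ℤₚ.pos-* 2 N)) (coeff-div-2+x (+ N) (suc n) ≈Z′ λ k N<k → Z≡0 k (ℕₚ.>⇒≢ N<k))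
    low : coeff (linear (+ 2) 1ℤ ⊗ P) (suc n) ≡ coeff Z (suc n) ⟨mod + (2 ℕ.* N) ⟩
    low = ≡mod-modulus (sym (ℤₚ.pos-* 2 N)) (coeff-div-1+2x (+ N) (suc n)
            (≈mod-trans (≈⇒≈mod (solve 3 (λ a b p → (b ⊠ (a ⊠ p)) ⊜ (a ⊠ (b ⊠ p))) ≈-refl (linear (+ 2) 1ℤ) (linear 1ℤ (+ 2)) P)) ≈Z′)
            λ k k<N₁ → Z≡0 k (ℕₚ.<⇒≢ (ℕₚ.m<n⇒m<1+n k<N₁)))

  coeff-decomposition : ∀ N D k → coeff (monomial N ⊕ (κ (+ N) ⊗ D)) k ≡ coeff (monomial N) k + + N * coeff D k
  coeff-decomposition N D k = trans (coeff-⊕ (monomial N) (κ (+ N) ⊗ D) k) (cong (_+_ (coeff (monomial N) k)) (coeff-κ⊗ (+ N) D k))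

  coeff-decomposition-≢ : ∀ N D k → k ≢ N → coeff (monomial N ⊕ (κ (+ N) ⊗ D)) k ≡ 0ℤ ⟨mod + N ⟩
  coeff-decomposition-≢ N D k k≢N = ≡mod-by (coeff D k) (begin
    coeff (monomial N ⊕ (κ (+ N) ⊗ D)) k - 0ℤ       ≡⟨ ℤₚ.+-identityʳ _ ⟩
    coeff (monomial N ⊕ (κ (+ N) ⊗ D)) k            ≡⟨ coeff-decomposition N D k ⟩
    coeff (monomial N) k + + N * coeff D k          ≡⟨ cong (_+ + N * coeff D k) (coeff-monomial-≢ N k k≢N) ⟩
    0ℤ + + N * coeff D k                            ≡⟨ trans (ℤₚ.+-identityˡ _) (ℤₚ.*-comm (+ N) (coeff D k)) ⟩
    coeff D k * + N                                 ∎)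
    where open ≡-Reasoning

  coeff-decomposition-difference : ∀ N₁ D → let N = suc N₁; Z = monomial N ⊕ (κ (+ N) ⊗ D) in
    coeff Z N₁ - coeff Z N ≡ -1ℤ - + N * coeff (oneMinusX ⊗ D) N
  coeff-decomposition-difference N₁ D = begin
    coeff Z N₁ - coeff Z N
      ≡⟨ cong₂ _-_ (coeff-decomposition N D N₁) (coeff-decomposition N D N) ⟩
    (coeff (monomial N) N₁ + + N * coeff D N₁) - (coeff (monomial N) N + + N * coeff D N)
      ≡⟨ cong₂ (λ a b → (a + + N * coeff D N₁) - (b + + N * coeff D N)) (coeff-monomial-≢ N N₁ (ℕₚ.<⇒≢ (ℕₚ.n<1+n N₁))) (coeff-monomial-self N) ⟩
    (0ℤ + + N * coeff D N₁) - (1ℤ + + N * coeff D N)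
      ≡⟨ identity (+ N) (coeff D N₁) (coeff D N) ⟩
    -1ℤ - + N * (1ℤ * coeff D N + -1ℤ * coeff D N₁)
      ≡⟨ cong (λ e → -1ℤ - + N * e) (coeff-linear⊗ 1ℤ -1ℤ D N₁) ⟨
    -1ℤ - + N * coeff (oneMinusX ⊗ D) N ∎
    where
    open ≡-Reasoning
    N = suc N₁
    Z = monomial N ⊕ (κ (+ N) ⊗ D)
    identity : ∀ n d₁ d₂ → (0ℤ + n * d₁) - (1ℤ + n * d₂) ≡ -1ℤ - n * (1ℤ * d₂ + -1ℤ * d₁)
    identity = solve-∀

  v-zero-from-block : ∀ N D → 2 ℕ.≤ N → symmetricBlock (2 ℕ.* N) -1ℤ ≈ monomial N ⊕ (κ (+ N) ⊗ D) ⟨mod + (2 ℕ.* N) ⟩ →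
    coeff (oneMinusX ⊗ D) N ≡ 1ℤ ⟨mod + 2 ⟩ → v N ≡ -1ℤ + + N ⟨mod + (2 ℕ.* N) ⟩
  v-zero-from-block (suc zero)    D (s≤s ()) _ _
  v-zero-from-block (suc (suc n)) D _ block≈ odd = begin
    v N
      ≈⟨ v≡coeff-difference n (≈mod-trans (≈mod-sym (symmetricBlock≈prodPoly (suc n))) block≈) (coeff-decomposition-≢ N D) ⟩
    coeff Z (suc n) - coeff Z N            ≡⟨ coeff-decomposition-difference (suc n) D ⟩
    -1ℤ - + N * coeff (oneMinusX ⊗ D) N    ≈⟨ ≡mod-+ (≡mod-refl -1ℤ) (≡mod-neg (≡mod-odd-multiple N odd)) ⟩
    -1ℤ - + N                              ≈⟨ ≡mod-by -1ℤ (trans (identity (+ N)) (cong (-1ℤ *_) (sym (ℤₚ.pos-* 2 N)))) ⟩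
    -1ℤ + + N                              ∎
    where
    N = suc (suc n)
    Z = monomial N ⊕ (κ (+ N) ⊗ D)
    open SetoidReasoning (≡mod-setoid (+ (2 ℕ.* N)))
    identity : ∀ x → -1ℤ - x - (-1ℤ + x) ≡ -1ℤ * (+ 2 * x)
    identity = solve-∀

  v-shift-zero : ∀ r → v (2 ^ suc r) ≡ -1ℤ + + (2 ^ suc r) ⟨mod + (2 ^ suc (suc r)) ⟩
  v-shift-zero r = v-zero-from-block (2 ^ suc r) D (ℕₚ.*-monoʳ-≤ 2 (ℕₚ.m^n>0 2 r)) block≈ odd
    where open BlockDecomposition (blockDecomposition r -1ℤ)

  v-shift : ∀ r i → v (2 ^ suc r ℕ.+ i) ≡ v i + + (2 ^ suc r) ⟨mod + (2 ^ suc (suc r)) ⟩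
  v-shift r zero    = subst (λ n → v n ≡ -1ℤ + + (2 ^ suc r) ⟨mod + (2 ^ suc (suc r)) ⟩) (sym (ℕₚ.+-identityʳ (2 ^ suc r))) (v-shift-zero r)
  v-shift r (suc j) = v-shift-suc r j

open import Data.Nat using (ℕ; _≤_; _+_; _∸_; _^_; zero; suc; s≤s)
open import Data.Integer using (+_)
import Data.Integer as ℤ
open import Data.Integer.Divisibility.Signed using (∣⇒∣ᵤ)

mainTheorem16 : (i q : ℕ) → 2 ≤ q →
    v (2 ^ (q ∸ 1) + i) ≡ v i ℤ.+ (+ (2 ^ (q ∸ 1))) [mod (+ (2 ^ q)) ]
mainTheorem16 i zero          ()
mainTheorem16 i (suc zero)    (s≤s ())
mainTheorem16 i (suc (suc r)) _        = ∣⇒∣ᵤ (≡mod⇒∣ (v-shift r i))
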